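{- Let $n\ge1$ and $a\ge1$ be integers, and let $k\ge 0$. Starting from the identity arrangement of a deck of $n$ cards, perform $k$ independent $a$-shuffles (Gilbert–Shannon–Reeds model). Then the probability that the resulting permutation has sign $1$ equals \[ \frac12+\frac{1}{2a^{k\lfloor n/2\rfloor}}. \]
   Context: An $a$-shuffle (GSR model) of a deck of $n$ cards: choose $(j_1,\dots,j_a)$ with $j_i\ge0$, $\sum j_i=n$, with probability $\binom{n}{j_1,\dots,j_a}/a^n$; cut the top $j_1$ cards, the next $j_2$ cards, etc., into $a$ packets; then drop cards one at a time, where if packet $i$ currently has $A_i$ cards, the next card is dropped from packet $i$ with probability $A_i/(A_1+\cdots+A_a)$, until all cards are dropped. The resulting arrangement is a permutation $w\in S_n$; started from the identity, the probability of obtaining $w$ after one $a$-shuffle is $\binom{n+a-\mathrm{des}(w^{ -1})-1}{n}/a^n$, where $\mathrm{des}(u)=|\{1\le i\le n-1:u(i)>u(i+1)\}|$. The sign $\mathrm{sgn}(w)$ is the usual sign of a permutation. -}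

module Defs where

open import Data.Nat as ℕ using (ℕ; zero; suc; _∸_; _^_; NonZero)
open import Data.Nat.Properties using (m^n≢0; m*n≢0)
open import Data.Nat.Combinatorics using (_C_)
open import Data.Fin as Fin using (Fin; toℕ)
open import Data.Vec as Vec using (Vec; []; _∷_; lookup; tabulate)
open import Data.Vec.Properties using (≡-dec)
open import Data.List as List using (List; []; _∷_; concatMap)
open import Data.Bool using (Bool; true; false; if_then_else_)
open import Data.Integer using (+_)
open import Data.Rational as ℚ using (ℚ; 0ℚ; 1ℚ; _+_; _*_)
open import Relation.Nullary using (does)

-- Permutations of {0,…,n-1} in one-line notation: w(i) = lookup w i.
Perm : ℕ → Set
Perm n = Vec (Fin n) n

insertions : ∀ {A : Set} {m} → A → Vec A m → List (Vec A (suc m))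
insertions x []       = (x ∷ []) ∷ []
insertions x (y ∷ ys) = (x ∷ y ∷ ys) ∷ List.map (y ∷_) (insertions x ys)

perms : (n : ℕ) → List (Perm n)
perms zero    = [] ∷ []
perms (suc n) = concatMap (λ p → insertions Fin.zero (Vec.map Fin.suc p)) (perms n)

identity : ∀ n → Perm n
identity n = tabulate (λ i → i)

_∘ₚ_ : ∀ {n} → Perm n → Perm n → Perm n
v ∘ₚ u = Vec.map (lookup v) u

inverse : ∀ {n} → Perm n → Perm n
inverse {n} w = tabulate (λ j → go j (List.allFin n))
  where
  go : Fin n → List (Fin n) → Fin n
  go j []       = j
  go j (i ∷ is) = if does (lookup w i Fin.≟ j) then i else go j is

desL : List ℕ → ℕ
desL []           = 0
desL (x ∷ [])     = 0
desL (x ∷ y ∷ zs) = (if does (y ℕ.<? x) then 1 else 0) ℕ.+ desL (y ∷ zs)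

des : ∀ {n} → Perm n → ℕ
des u = desL (Vec.toList (Vec.map toℕ u))

invL : List ℕ → ℕ
invL []       = 0
invL (x ∷ xs) = List.length (List.filter (λ y → y ℕ.<? x) xs) ℕ.+ invL xs

inversions : ∀ {n} → Perm n → ℕ
inversions w = invL (Vec.toList (Vec.map toℕ w))

-- sgn(w) = 1  iff the number of inversions is even
sgnIsOne : ∀ {n} → Perm n → Bool
sgnIsOne w = does (inversions w ℕ.% 2 ℕ.≟ 0)

sumℚ : List ℚ → ℚ
sumℚ = List.foldr _+_ 0ℚ

-- probability of w after one a-shuffle from the identity:
--   C(n + a - des(w⁻¹) - 1, n) / a^n
shuffleProb : ∀ {n} (a : ℕ) → .{{NonZero a}} → Perm n → ℚ
shuffleProb {n} a w =
  ℚ._/_ (+ ((n ℕ.+ a ∸ des (inverse w) ∸ 1) C n)) (a ^ n) {{m^n≢0 a n}}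

iterProb : ∀ {n} (a : ℕ) → .{{NonZero a}} → ℕ → Perm n → ℚ
iterProb {n} a zero    w = if does (≡-dec Fin._≟_ w (identity n)) then 1ℚ else 0ℚ
iterProb {n} a (suc k) w =
  sumℚ (List.map (λ u → sumℚ (List.map (λ v →
      if does (≡-dec Fin._≟_ (v ∘ₚ u) w)
        then iterProb a k u * shuffleProb a v
        else 0ℚ) (perms n))) (perms n))

probSignOne : (n a : ℕ) → .{{NonZero a}} → ℕ → ℚ
probSignOne n a k =
  sumℚ (List.map (λ w → if sgnIsOne w then iterProb a k w else 0ℚ) (perms n))

rhs : (n a : ℕ) → .{{NonZero a}} → ℕ → ℚ
rhs n a k = (+ 1) ℚ./ 2 + ℚ._/_ (+ 1) (2 ℕ.* a ^ (k ℕ.* (n ℕ./ 2))) {{m*n≢0 2 (a ^ (k ℕ.* (n ℕ./ 2))) {{_}} {{m^n≢0 a (k ℕ.* (n ℕ./ 2))}}}}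

-- An a-shuffle of n cards amounts to a uniformly random word z ∈ {0,…,a-1}ⁿ (the packet of each card):
-- the numerator C(n + a - des(p⁻¹) - 1, n) of shuffleProb a p counts the words whose standardization is p.
-- Since sgn is multiplicative, the signed mass of the distribution after k shuffles is rᵏ, where r is the
-- signed mass of one shuffle, while the total mass stays 1; hence P(sgn = 1) = (1 + rᵏ)/2.
-- Finally aⁿ r = Σ_z (-1)^inv(z). Summing over the first two letters x, y of z, the terms for (x, y) and
-- (y, x) cancel when x ≠ y and the a diagonal terms contribute 1 each, so Σ_z (-1)^inv(z) = a^⌈n/2⌉
-- and r = a^-⌊n/2⌋.

module Submission where

open import Defs
open import Data.Nat using (ℕ; _≤_; NonZero)
open import Relation.Binary.PropositionalEquality using (_≡_)

open import Data.Bool using (Bool; true; false; if_then_else_; not; _∧_; _∨_; T)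
import Data.Bool.Properties as Bool
open import Data.Empty using (⊥-elim)
open import Data.Fin as Fin using (Fin; zero; suc; toℕ; punchIn; punchOut)
import Data.Fin.Properties as Fin
import Data.Integer as ℤ
import Data.Integer.Properties as ℤ
open import Data.List as List using (List; []; _∷_; _++_; allFin; concatMap)
import Data.List.Properties as List
open import Data.List.Relation.Unary.All as All using (All; []; _∷_)
import Data.List.Relation.Unary.All.Properties as All
open import Data.List.Membership.Propositional using (_∈_)
open import Data.List.Membership.Propositional.Properties using (∈-allFin)
open import Data.List.Relation.Unary.Any using (here; there)
open import Data.Nat as ℕ using (zero; suc; _<_; z≤n; s≤s; _<?_; _≤?_; _∸_; _^_; ⌊_/2⌋; ⌈_/2⌉)
import Data.Nat.Properties as ℕ
import Data.Nat.DivMod as ℕ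
open import Data.Nat.Combinatorics using (_C_; k>n⇒nCk≡0; nCk+nC[k+1]≡[n+1]C[k+1])
open import Data.Product using (∃; ∃₂; _×_; _,_; proj₁; proj₂)
open import Data.Rational as ℚ using (ℚ; 0ℚ; 1ℚ; ½; _+_; _*_; _-_; -_)
open import Data.Rational.Unnormalised as ℚᵘ using (mkℚᵘ; *≡*)
import Data.Rational.Properties as ℚ
import Data.Rational.Unnormalised.Properties as ℚᵘ
open import Data.Rational.Solver using (module +-*-Solver)
open import Algebra.Definitions.RawSemiring ℚ.+-*-rawSemiring using () renaming (_^_ to _^ℚ_)
open import Data.Sum using (_⊎_; inj₁; inj₂)
open import Data.Vec as Vec using (Vec; []; _∷_; lookup; tabulate; insertAt; removeAt; toList)
import Data.Vec.Properties as Vec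
open import Function using (_∘_; id)
open import Relation.Binary.PropositionalEquality
open import Relation.Nullary using (Dec; yes; no; does)
open import Relation.Binary.Definitions using (tri<; tri≈; tri>)
open import Relation.Nullary.Decidable using (dec-true; dec-false)
open import Algebra.Properties.CommutativeSemigroup ℕ.+-commutativeSemigroup using (x∙yz≈y∙xz)

private
  variable
    A B : Set

-- Finite sums

∑ : {A : Set} → List A → (A → ℚ) → ℚ
∑ L f = sumℚ (List.map f L)

infix 5 ∑
syntax ∑ L (λ x → e) = ∑[ x ∈ L ] e

∑-cong : ∀ (L : List A) {f g : A → ℚ} → (∀ x → f x ≡ g x) → ∑ L f ≡ ∑ L g
∑-cong []      f≗g = refl
∑-cong (x ∷ L) f≗g = cong₂ _+_ (f≗g x) (∑-cong L f≗g)

∑-cong-All : ∀ {P : A → Set} (L : List A) {f g : A → ℚ} →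
             All P L → (∀ x → P x → f x ≡ g x) → ∑ L f ≡ ∑ L g
∑-cong-All []      []         f≗g = refl
∑-cong-All (x ∷ L) (px ∷ pL) f≗g = cong₂ _+_ (f≗g x px) (∑-cong-All L pL f≗g)

∑-++ : ∀ (L M : List A) (f : A → ℚ) → ∑ (L ++ M) f ≡ ∑ L f + ∑ M f
∑-++ []      M f = sym (ℚ.+-identityˡ _)
∑-++ (x ∷ L) M f = trans (cong (f x +_) (∑-++ L M f)) (sym (ℚ.+-assoc (f x) _ _))

∑-map : (h : B → A) (L : List B) (f : A → ℚ) → ∑ (List.map h L) f ≡ ∑ L (f ∘ h)
∑-map h []      f = refl
∑-map h (x ∷ L) f = cong (f (h x) +_) (∑-map h L f)

∑-concatMap : (h : B → List A) (L : List B) (f : A → ℚ) →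
              ∑ (concatMap h L) f ≡ ∑[ x ∈ L ] ∑ (h x) f
∑-concatMap h []      f = refl
∑-concatMap h (x ∷ L) f = trans (∑-++ (h x) (concatMap h L) f) (cong (∑ (h x) f +_) (∑-concatMap h L f))

∑-zero : ∀ (L : List A) → ∑[ _ ∈ L ] 0ℚ ≡ 0ℚ
∑-zero []      = refl
∑-zero (x ∷ L) = trans (ℚ.+-identityˡ _) (∑-zero L)

∑-+ : ∀ (L : List A) (f g : A → ℚ) → ∑[ x ∈ L ] f x + g x ≡ ∑ L f + ∑ L g
∑-+ []      f g = refl
∑-+ (x ∷ L) f g = trans (cong (f x + g x +_) (∑-+ L f g)) (+-interchange (f x) (g x) (∑ L f) (∑ L g))
  where
  open +-*-Solver
  +-interchange : ∀ p q r s → (p + q) + (r + s) ≡ (p + r) + (q + s)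
  +-interchange = solve 4 (λ p q r s → (p :+ q) :+ (r :+ s) := (p :+ r) :+ (q :+ s)) refl

∑-neg : ∀ (L : List A) (f : A → ℚ) → ∑[ x ∈ L ] - f x ≡ - ∑ L f
∑-neg []      f = refl
∑-neg (x ∷ L) f = trans (cong (- f x +_) (∑-neg L f)) (sym (ℚ.neg-distrib-+ (f x) _))

∑-minus : ∀ (L : List A) (f g : A → ℚ) → ∑[ x ∈ L ] f x - g x ≡ ∑ L f - ∑ L g
∑-minus L f g = trans (∑-+ L f (-_ ∘ g)) (cong (∑ L f +_) (∑-neg L g))

∑-*ˡ : ∀ (L : List A) (c : ℚ) (f : A → ℚ) → ∑[ x ∈ L ] c * f x ≡ c * ∑ L f
∑-*ˡ []      c f = sym (ℚ.*-zeroʳ c)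
∑-*ˡ (x ∷ L) c f = trans (cong (c * f x +_) (∑-*ˡ L c f)) (sym (ℚ.*-distribˡ-+ c (f x) _))

∑-*ʳ : ∀ (L : List A) (f : A → ℚ) (c : ℚ) → ∑[ x ∈ L ] f x * c ≡ ∑ L f * c
∑-*ʳ L f c = trans (∑-cong L (λ x → ℚ.*-comm (f x) c)) (trans (∑-*ˡ L c f) (ℚ.*-comm c (∑ L f)))

∑-comm : (L : List A) (M : List B) (f : A → B → ℚ) →
         ∑[ x ∈ L ] ∑[ y ∈ M ] f x y ≡ ∑[ y ∈ M ] ∑[ x ∈ L ] f x y
∑-comm []      M f = sym (∑-zero M)
∑-comm (x ∷ L) M f = trans (cong (∑ M (f x) +_) (∑-comm L M f)) (sym (∑-+ M (f x) (λ y → ∑[ x ∈ L ] f x y)))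

∑-if : ∀ (L : List A) (b : Bool) (f : A → ℚ) →
       ∑[ x ∈ L ] (if b then f x else 0ℚ) ≡ (if b then ∑ L f else 0ℚ)
∑-if L true  f = refl
∑-if L false f = ∑-zero L

∧-true : ∀ {b c} → b ∧ c ≡ true → b ≡ true × c ≡ true
∧-true {true} {true} _ = refl , refl

does-true : ∀ {P : Set} (p? : Dec P) → does p? ≡ true → P
does-true (yes p) _ = p

does-⇔ : ∀ {P Q : Set} → (P → Q) → (Q → P) → (p? : Dec P) (q? : Dec Q) → does p? ≡ does q?
does-⇔ P→Q Q→P (yes p) q? = sym (dec-true q? (P→Q p))
does-⇔ P→Q Q→P (no ¬p) q? = sym (dec-false q? (¬p ∘ Q→P))

if-∧ : ∀ (b c : Bool) (x : ℚ) → (if b ∧ c then x else 0ℚ) ≡ (if b then (if c then x else 0ℚ) else 0ℚ)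
if-∧ true  c x = refl
if-∧ false c x = refl

if-split : ∀ c (q : ℚ) → q ≡ (if c then q else 0ℚ) + (if not c then q else 0ℚ)
if-split true  q = sym (ℚ.+-identityʳ q)
if-split false q = sym (ℚ.+-identityˡ q)

if-comm : ∀ b c (q : ℚ) → (if b then (if c then q else 0ℚ) else 0ℚ) ≡ (if c then (if b then q else 0ℚ) else 0ℚ)
if-comm b c q = trans (sym (if-∧ b c q)) (trans (cong (λ d → if d then q else 0ℚ) (Bool.∧-comm b c)) (if-∧ c b q))

if-congᵗ : ∀ b {x y : ℚ} → (b ≡ true → x ≡ y) → (if b then x else 0ℚ) ≡ (if b then y else 0ℚ)
if-congᵗ true  x≡y = x≡y refl
if-congᵗ false _   = refl

if-∨ : ∀ b c (q : ℚ) → (if b ∨ c then q else 0ℚ) ≡ ((if b then q else 0ℚ) + (if c then q else 0ℚ)) - (if b then (if c then q else 0ℚ) else 0ℚ)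
if-∨ true  true  q = solve 1 (λ q → q := (q :+ q) :- q) refl q
  where open +-*-Solver
if-∨ true  false q = solve 1 (λ q → q := (q :+ con 0ℚ) :- con 0ℚ) refl q
  where open +-*-Solver
if-∨ false true  q = solve 1 (λ q → q := (con 0ℚ :+ q) :- con 0ℚ) refl q
  where open +-*-Solver
if-∨ false false q = refl

if-*ˡ : ∀ (c : ℚ) b (x : ℚ) → c * (if b then x else 0ℚ) ≡ (if b then c * x else 0ℚ)
if-*ˡ c true  x = refl
if-*ˡ c false x = ℚ.*-zeroʳ c

∑-allFin-suc : ∀ {m} (f : Fin (suc m) → ℚ) → ∑ (allFin (suc m)) f ≡ f zero + (∑[ j ∈ allFin m ] f (suc j))
∑-allFin-suc {m} f = cong (f zero +_) (trans (cong (λ L → ∑ L f) (sym (List.map-tabulate id suc))) (∑-map suc (allFin m) f))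

-- Natural numbers and signs in ℚ

fromℕ : ℕ → ℚ
fromℕ n = ℤ.+ n ℚ./ 1

1/ℕ : (d : ℕ) → .{{NonZero d}} → ℚ
1/ℕ d = ℤ.+ 1 ℚ./ d

fromℚᵘ-homo-+ : ∀ p q → ℚ.fromℚᵘ (p ℚᵘ.+ q) ≡ ℚ.fromℚᵘ p + ℚ.fromℚᵘ q
fromℚᵘ-homo-+ p q = ℚ.toℚᵘ-injective (ℚᵘ.≃-trans (ℚ.toℚᵘ-fromℚᵘ (p ℚᵘ.+ q))
  (ℚᵘ.≃-sym (ℚᵘ.≃-trans (ℚ.toℚᵘ-homo-+ (ℚ.fromℚᵘ p) (ℚ.fromℚᵘ q)) (ℚᵘ.+-cong (ℚ.toℚᵘ-fromℚᵘ p) (ℚ.toℚᵘ-fromℚᵘ q)))))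

fromℚᵘ-homo-* : ∀ p q → ℚ.fromℚᵘ (p ℚᵘ.* q) ≡ ℚ.fromℚᵘ p * ℚ.fromℚᵘ q
fromℚᵘ-homo-* p q = ℚ.toℚᵘ-injective (ℚᵘ.≃-trans (ℚ.toℚᵘ-fromℚᵘ (p ℚᵘ.* q))
  (ℚᵘ.≃-sym (ℚᵘ.≃-trans (ℚ.toℚᵘ-homo-* (ℚ.fromℚᵘ p) (ℚ.fromℚᵘ q)) (ℚᵘ.*-cong (ℚ.toℚᵘ-fromℚᵘ p) (ℚ.toℚᵘ-fromℚᵘ q)))))

fromℕ-+ : ∀ m n → fromℕ (m ℕ.+ n) ≡ fromℕ m + fromℕ n
fromℕ-+ m n = trans (ℚ.fromℚᵘ-cong {mkℚᵘ (ℤ.+ (m ℕ.+ n)) 0} {mkℚᵘ (ℤ.+ m) 0 ℚᵘ.+ mkℚᵘ (ℤ.+ n) 0} (*≡* eq)) (fromℚᵘ-homo-+ (mkℚᵘ (ℤ.+ m) 0) (mkℚᵘ (ℤ.+ n) 0))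
  where
  eq : ℤ.+ (m ℕ.+ n) ℤ.* ℤ.+ 1 ≡ (ℤ.+ m ℤ.* ℤ.+ 1 ℤ.+ ℤ.+ n ℤ.* ℤ.+ 1) ℤ.* ℤ.+ 1
  eq = cong (ℤ._* ℤ.+ 1) (trans (ℤ.pos-+ m n) (sym (cong₂ ℤ._+_ (ℤ.*-identityʳ (ℤ.+ m)) (ℤ.*-identityʳ (ℤ.+ n)))))

fromℕ-* : ∀ m n → fromℕ (m ℕ.* n) ≡ fromℕ m * fromℕ n
fromℕ-* m n = trans (ℚ.fromℚᵘ-cong {mkℚᵘ (ℤ.+ (m ℕ.* n)) 0} {mkℚᵘ (ℤ.+ m) 0 ℚᵘ.* mkℚᵘ (ℤ.+ n) 0} (*≡* (cong (ℤ._* ℤ.+ 1) (ℤ.pos-* m n)))) (fromℚᵘ-homo-* (mkℚᵘ (ℤ.+ m) 0) (mkℚᵘ (ℤ.+ n) 0))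

/-≡-fromℕ-*-1/ℕ : ∀ m d .{{_ : NonZero d}} → ℤ.+ m ℚ./ d ≡ fromℕ m * 1/ℕ d
/-≡-fromℕ-*-1/ℕ m (suc d) = trans (ℚ.fromℚᵘ-cong {mkℚᵘ (ℤ.+ m) d} {mkℚᵘ (ℤ.+ m) 0 ℚᵘ.* mkℚᵘ (ℤ.+ 1) d} (*≡* eq)) (fromℚᵘ-homo-* (mkℚᵘ (ℤ.+ m) 0) (mkℚᵘ (ℤ.+ 1) d))
  where
  eq : ℤ.+ m ℤ.* ℤ.+ (1 ℕ.* suc d) ≡ (ℤ.+ m ℤ.* ℤ.+ 1) ℤ.* ℤ.+ suc d
  eq = cong₂ ℤ._*_ (sym (ℤ.*-identityʳ (ℤ.+ m))) (cong ℤ.+_ (ℕ.*-identityˡ (suc d)))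

fromℕ-*-1/ℕ : ∀ d .{{_ : NonZero d}} → fromℕ d * 1/ℕ d ≡ 1ℚ
fromℕ-*-1/ℕ d@(suc d-1) = trans (sym (/-≡-fromℕ-*-1/ℕ d d)) (ℚ.fromℚᵘ-cong {mkℚᵘ (ℤ.+ d) d-1} {mkℚᵘ (ℤ.+ 1) 0} (*≡* (ℤ.*-comm (ℤ.+ d) (ℤ.+ 1))))

1/ℕ-* : ∀ d e .{{_ : NonZero d}} .{{_ : NonZero e}} → 1/ℕ (d ℕ.* e) {{ℕ.m*n≢0 d e}} ≡ 1/ℕ d * 1/ℕ e
1/ℕ-* (suc d) (suc e) = fromℚᵘ-homo-* (mkℚᵘ (ℤ.+ 1) d) (mkℚᵘ (ℤ.+ 1) e)

∑-const : ∀ (L : List A) (c : ℚ) → ∑[ _ ∈ L ] c ≡ fromℕ (List.length L) * c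
∑-const []      c = sym (ℚ.*-zeroˡ c)
∑-const (x ∷ L) c = begin
  c + ∑ L (λ _ → c)                       ≡⟨ cong₂ _+_ (sym (ℚ.*-identityˡ c)) (∑-const L c) ⟩
  1ℚ * c + fromℕ (List.length L) * c      ≡⟨ ℚ.*-distribʳ-+ c 1ℚ (fromℕ (List.length L)) ⟨
  (1ℚ + fromℕ (List.length L)) * c        ≡⟨ cong (_* c) (fromℕ-+ 1 (List.length L)) ⟨
  fromℕ (suc (List.length L)) * c         ∎
  where open ≡-Reasoning

infix 8 [-1]^_

[-1]^_ : ℕ → ℚ
[-1]^ zero  = 1ℚ
[-1]^ suc n = - [-1]^ n

[-1]^-+ : ∀ m n → [-1]^ (m ℕ.+ n) ≡ [-1]^ m * [-1]^ n
[-1]^-+ zero    n = sym (ℚ.*-identityˡ _)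
[-1]^-+ (suc m) n = trans (cong -_ ([-1]^-+ m n)) (ℚ.neg-distribˡ-* ([-1]^ m) ([-1]^ n))

[-1]^-square : ∀ n → [-1]^ n * [-1]^ n ≡ 1ℚ
[-1]^-square zero    = refl
[-1]^-square (suc n) = trans (solve 1 (λ x → (:- x) :* (:- x) := x :* x) refl ([-1]^ n)) ([-1]^-square n)
  where open +-*-Solver

-- Permutations built by inserting 0

record IsPerm {n} (w : Perm n) : Set where
  field
    injective  : ∀ i j → lookup w i ≡ lookup w j → i ≡ j
    surjective : ∀ y → ∃ λ i → lookup w i ≡ y

open IsPerm

lookup-ext : ∀ {n} {xs ys : Vec A n} → (∀ i → lookup xs i ≡ lookup ys i) → xs ≡ ys
lookup-ext {xs = xs} {ys} eq = trans (sym (Vec.tabulate∘lookup xs)) (trans (Vec.tabulate-cong eq) (Vec.tabulate∘lookup ys))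

-- The search loop of `inverse` is bound in a where-block, so it is named here by unification.
mutual
  inverseSearch : ∀ {n} → Perm n → Fin n → List (Fin n) → Fin n
  inverseSearch w = _

  inverse-≡-tabulate : ∀ {n} (w : Perm n) → inverse w ≡ tabulate (λ y → inverseSearch w y (allFin n))
  inverse-≡-tabulate {n} w with allFin n
  ... | _ = refl

inverseSearch-found : ∀ {n} (w : Perm n) → IsPerm w → ∀ {i y} → lookup w i ≡ y →
                      ∀ L → i ∈ L → inverseSearch w y L ≡ i
inverseSearch-found w w-perm {i} {y} wi≡y (k ∷ L) i∈kL with lookup w k Fin.≟ y
... | yes wk≡y = injective w-perm k i (trans wk≡y (sym wi≡y))
inverseSearch-found w w-perm wi≡y (k ∷ L) (here refl)  | no wk≢y = ⊥-elim (wk≢y wi≡y)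
inverseSearch-found w w-perm wi≡y (k ∷ L) (there i∈L) | no _    = inverseSearch-found w w-perm wi≡y L i∈L

lookup-inverse : ∀ {n} (w : Perm n) → IsPerm w → ∀ {i y} → lookup w i ≡ y → lookup (inverse w) y ≡ i
lookup-inverse {n} w w-perm {i} {y} wi≡y = begin
  lookup (inverse w) y                                         ≡⟨ cong (λ v → lookup v y) (inverse-≡-tabulate w) ⟩
  lookup (tabulate (λ y → inverseSearch w y (allFin n))) y     ≡⟨ Vec.lookup∘tabulate _ y ⟩
  inverseSearch w y (allFin n)                                 ≡⟨ inverseSearch-found w w-perm wi≡y (allFin n) (∈-allFin i) ⟩
  i                                                            ∎
  where open ≡-Reasoning

lookup-lookup-inverse : ∀ {n} (w : Perm n) → IsPerm w → ∀ y → lookup w (lookup (inverse w) y) ≡ y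
lookup-lookup-inverse w w-perm y with surjective w-perm y
... | i , wi≡y = trans (cong (lookup w) (lookup-inverse w w-perm wi≡y)) wi≡y

identity-isPerm : ∀ n → IsPerm (identity n)
identity-isPerm n = record
  { injective  = λ i j eq → trans (sym (Vec.lookup∘tabulate id i)) (trans eq (Vec.lookup∘tabulate id j))
  ; surjective = λ y → y , Vec.lookup∘tabulate id y
  }

lookup-∘ₚ : ∀ {n} (v u : Perm n) i → lookup (v ∘ₚ u) i ≡ lookup v (lookup u i)
lookup-∘ₚ v u i = Vec.lookup-map i (lookup v) u

∘ₚ-isPerm : ∀ {n} {v u : Perm n} → IsPerm v → IsPerm u → IsPerm (v ∘ₚ u)
∘ₚ-isPerm {v = v} {u} v-perm u-perm = record
  { injective  = λ i j eq → injective u-perm i j (injective v-perm _ _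
                   (trans (sym (lookup-∘ₚ v u i)) (trans eq (lookup-∘ₚ v u j))))
  ; surjective = surj
  }
  where
  surj : ∀ y → ∃ λ i → lookup (v ∘ₚ u) i ≡ y
  surj y with surjective v-perm y
  ... | k , vk≡y with surjective u-perm k
  ... | i , ui≡k = i , trans (lookup-∘ₚ v u i) (trans (cong (lookup v) ui≡k) vk≡y)

insert₀ : ∀ {n} → Perm n → Fin (suc n) → Perm (suc n)
insert₀ p j = insertAt (Vec.map suc p) j zero

lookup-insert₀-at : ∀ {n} (p : Perm n) j → lookup (insert₀ p j) j ≡ zero
lookup-insert₀-at p j = Vec.insertAt-lookup (Vec.map suc p) j zero

lookup-insert₀-punchIn : ∀ {n} (p : Perm n) j k → lookup (insert₀ p j) (punchIn j k) ≡ suc (lookup p k)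
lookup-insert₀-punchIn p j k = trans (Vec.insertAt-punchIn (Vec.map suc p) j zero k) (Vec.lookup-map k suc p)

≡⊎punchIn : ∀ {n} (j k : Fin (suc n)) → j ≡ k ⊎ ∃ λ i → punchIn j i ≡ k
≡⊎punchIn j k with j Fin.≟ k
... | yes j≡k = inj₁ j≡k
... | no  j≢k = inj₂ (punchOut j≢k , Fin.punchIn-punchOut j≢k)

lookup-insert₀≡zero⇒at : ∀ {n} (p : Perm n) j k → lookup (insert₀ p j) k ≡ zero → k ≡ j
lookup-insert₀≡zero⇒at p j k eq with ≡⊎punchIn j k
... | inj₁ j≡k = sym j≡k
... | inj₂ (i , refl) with () ← trans (sym (lookup-insert₀-punchIn p j i)) eq

insert₀-isPerm : ∀ {n} {p : Perm n} → IsPerm p → ∀ j → IsPerm (insert₀ p j)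
insert₀-isPerm {p = p} p-perm j = record { injective = inj ; surjective = surj }
  where
  inj : ∀ k l → lookup (insert₀ p j) k ≡ lookup (insert₀ p j) l → k ≡ l
  inj k l eq with ≡⊎punchIn j k | ≡⊎punchIn j l
  ... | inj₁ refl       | inj₁ refl       = refl
  ... | inj₁ refl       | inj₂ (i , refl) with () ← trans (sym (lookup-insert₀-at p j)) (trans eq (lookup-insert₀-punchIn p j i))
  ... | inj₂ (i , refl) | inj₁ refl       with () ← trans (sym (lookup-insert₀-punchIn p j i)) (trans eq (lookup-insert₀-at p j))
  ... | inj₂ (i , refl) | inj₂ (i′ , refl) = cong (punchIn j) (injective p-perm i i′
        (Fin.suc-injective (trans (sym (lookup-insert₀-punchIn p j i)) (trans eq (lookup-insert₀-punchIn p j i′)))))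
  surj : ∀ y → ∃ λ k → lookup (insert₀ p j) k ≡ y
  surj zero    = j , lookup-insert₀-at p j
  surj (suc y) with surjective p-perm y
  ... | i , pi≡y = punchIn j i , trans (lookup-insert₀-punchIn p j i) (cong suc pi≡y)

map-suc-injective : ∀ {n k} {p q : Vec (Fin n) k} → Vec.map (Fin.suc {n}) p ≡ Vec.map suc q → p ≡ q
map-suc-injective {p = []}    {[]}    _  = refl
map-suc-injective {p = x ∷ p} {y ∷ q} eq =
  cong₂ _∷_ (Fin.suc-injective (Vec.∷-injectiveˡ eq)) (map-suc-injective (Vec.∷-injectiveʳ eq))

insert₀-injective : ∀ {n} {p q : Perm n} {j k} → insert₀ p j ≡ insert₀ q k → j ≡ k × p ≡ q
insert₀-injective {p = p} {q} {j} {k} eq = j≡k , map-suc-injective (begin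
  Vec.map suc p                  ≡⟨ Vec.removeAt-insertAt (Vec.map suc p) j zero ⟨
  removeAt (insert₀ p j) j       ≡⟨ cong₂ removeAt eq j≡k ⟩
  removeAt (insert₀ q k) k       ≡⟨ Vec.removeAt-insertAt (Vec.map suc q) k zero ⟩
  Vec.map suc q                  ∎)
  where
  open ≡-Reasoning
  j≡k : j ≡ k
  j≡k = lookup-insert₀≡zero⇒at q k j (trans (cong (λ v → lookup v j) (sym eq)) (lookup-insert₀-at p j))

lookup-removeAt : ∀ {n} (xs : Vec A (suc n)) i k → lookup (removeAt xs i) k ≡ lookup xs (punchIn i k)
lookup-removeAt xs i k = trans (cong (lookup (removeAt xs i)) (sym (Fin.punchOut-punchIn i)))
                               (Vec.removeAt-punchOut xs (Fin.punchInᵢ≢i i k ∘ sym))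

map-suc-image : ∀ {n k} (v : Vec (Fin (suc n)) k) → (∀ i → lookup v i ≢ zero) → ∃ λ p → v ≡ Vec.map suc p
map-suc-image []          _   = [] , refl
map-suc-image (zero  ∷ v) v≢0 = ⊥-elim (v≢0 zero refl)
map-suc-image (suc x ∷ v) v≢0 with map-suc-image v (v≢0 ∘ suc)
... | p , refl = x ∷ p , refl

isPerm⇒insert₀ : ∀ {n} {x : Perm (suc n)} → IsPerm x → ∃₂ λ p j → IsPerm p × x ≡ insert₀ p j
isPerm⇒insert₀ {x = x} x-perm with surjective x-perm zero
... | j , xj≡0 with map-suc-image (removeAt x j) rest≢0
  where
  rest≢0 : ∀ k → lookup (removeAt x j) k ≢ zero
  rest≢0 k eq = Fin.punchInᵢ≢i j k (injective x-perm _ _ (trans (sym (lookup-removeAt x j k)) (trans eq (sym xj≡0))))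
... | p , rest≡ = p , j , record { injective = inj ; surjective = surj } , x≡
  where
  x≡ : x ≡ insert₀ p j
  x≡ = trans (sym (Vec.insertAt-removeAt x j)) (cong₂ (λ v y → insertAt v j y) rest≡ xj≡0)
  suc-p : ∀ k → suc (lookup p k) ≡ lookup x (punchIn j k)
  suc-p k = trans (sym (lookup-insert₀-punchIn p j k)) (cong (λ v → lookup v (punchIn j k)) (sym x≡))
  inj : ∀ k l → lookup p k ≡ lookup p l → k ≡ l
  inj k l eq = Fin.punchIn-injective j k l (injective x-perm _ _ (trans (sym (suc-p k)) (trans (cong suc eq) (suc-p l))))
  surj : ∀ y → ∃ λ k → lookup p k ≡ y
  surj y with surjective x-perm (suc y)
  ... | i , xi≡y with ≡⊎punchIn j i
  ... | inj₁ refl       with () ← trans (sym xj≡0) xi≡y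
  ... | inj₂ (k , refl) = k , Fin.suc-injective (trans (suc-p k) xi≡y)

insertions-≡-map-insertAt : ∀ {m} (x : A) (v : Vec A m) →
                            insertions x v ≡ List.map (λ j → insertAt v j x) (allFin (suc m))
insertions-≡-map-insertAt x []                = refl
insertions-≡-map-insertAt {m = suc m} x (y ∷ ys) = cong ((x ∷ y ∷ ys) ∷_) (begin
  List.map (y ∷_) (insertions x ys)                                   ≡⟨ cong (List.map (y ∷_)) (insertions-≡-map-insertAt x ys) ⟩
  List.map (y ∷_) (List.map (λ j → insertAt ys j x) (allFin (suc m)))  ≡⟨ List.map-∘ (allFin (suc m)) ⟨
  List.map (λ j → y ∷ insertAt ys j x) (allFin (suc m))               ≡⟨ List.map-tabulate id _ ⟩
  List.tabulate (λ j → insertAt (y ∷ ys) (suc j) x)                   ≡⟨ List.map-tabulate suc _ ⟨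
  List.map (λ j → insertAt (y ∷ ys) j x) (List.tabulate suc)          ∎)
  where open ≡-Reasoning

∑-perms-suc : ∀ {n} (f : Perm (suc n) → ℚ) →
              ∑ (perms (suc n)) f ≡ ∑[ p ∈ perms n ] ∑[ j ∈ allFin (suc n) ] f (insert₀ p j)
∑-perms-suc {n} f = trans (∑-concatMap _ (perms n) f) (∑-cong (perms n) λ p →
  trans (cong (λ L → ∑ L f) (insertions-≡-map-insertAt zero (Vec.map suc p))) (∑-map (insert₀ p) (allFin (suc n)) f))

perms-isPerm : ∀ n → All IsPerm (perms n)
perms-isPerm zero    = record { injective = λ () ; surjective = λ () } ∷ []
perms-isPerm (suc n) = All.concat⁺ (All.gmap⁺ insertions-isPerm (perms-isPerm n))
  where
  insertions-isPerm : ∀ {p} → IsPerm p → All IsPerm (insertions zero (Vec.map suc p))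
  insertions-isPerm {p} p-perm = subst (All IsPerm) (sym (insertions-≡-map-insertAt zero (Vec.map suc p)))
                                       (All.map⁺ (All.tabulate⁺ (insert₀-isPerm p-perm)))

∑-allFin-δ : ∀ {m} (j₀ : Fin m) (f : Fin m → ℚ) → ∑[ j ∈ allFin m ] (if does (j₀ Fin.≟ j) then f j else 0ℚ) ≡ f j₀
∑-allFin-δ {suc m} zero f = begin
  ∑[ j ∈ allFin (suc m) ] (if does (zero Fin.≟ j) then f j else 0ℚ)   ≡⟨ ∑-allFin-suc (λ j → if does (zero Fin.≟ j) then f j else 0ℚ) ⟩
  f zero + (∑[ j ∈ allFin m ] 0ℚ)                                      ≡⟨ cong (f zero +_) (∑-zero (allFin m)) ⟩
  f zero + 0ℚ                                                           ≡⟨ ℚ.+-identityʳ (f zero) ⟩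
  f zero                                                                ∎
  where open ≡-Reasoning
∑-allFin-δ {suc m} (suc j₀) f = begin
  ∑[ j ∈ allFin (suc m) ] (if does (suc j₀ Fin.≟ j) then f j else 0ℚ)            ≡⟨ ∑-allFin-suc (λ j → if does (suc j₀ Fin.≟ j) then f j else 0ℚ) ⟩
  0ℚ + (∑[ j ∈ allFin m ] (if does (suc j₀ Fin.≟ suc j) then f (suc j) else 0ℚ))  ≡⟨ ℚ.+-identityˡ _ ⟩
  ∑[ j ∈ allFin m ] (if does (suc j₀ Fin.≟ suc j) then f (suc j) else 0ℚ)         ≡⟨ ∑-cong (allFin m) suc-≟ ⟩
  ∑[ j ∈ allFin m ] (if does (j₀ Fin.≟ j) then f (suc j) else 0ℚ)                 ≡⟨ ∑-allFin-δ j₀ (f ∘ suc) ⟩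
  f (suc j₀)                                                                       ∎
  where
  open ≡-Reasoning
  suc-≟ : ∀ j → (if does (suc j₀ Fin.≟ suc j) then f (suc j) else 0ℚ) ≡ (if does (j₀ Fin.≟ j) then f (suc j) else 0ℚ)
  suc-≟ j with j₀ Fin.≟ j
  ... | yes _ = refl
  ... | no  _ = refl

infix 4 _≟ₚ_

_≟ₚ_ : ∀ {n} (v w : Perm n) → Dec (v ≡ w)
_≟ₚ_ = Vec.≡-dec Fin._≟_

insert₀-≟ : ∀ {n} (p q : Perm n) j k → does (insert₀ p j ≟ₚ insert₀ q k) ≡ does (j Fin.≟ k) ∧ does (p ≟ₚ q)
insert₀-≟ p q j k with insert₀ p j ≟ₚ insert₀ q k | j Fin.≟ k | p ≟ₚ q
... | yes eq  | yes _    | yes _    = refl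
... | yes eq  | no j≢k   | _        = ⊥-elim (j≢k (proj₁ (insert₀-injective eq)))
... | yes eq  | yes _    | no p≢q   = ⊥-elim (p≢q (proj₂ (insert₀-injective eq)))
... | no  neq | yes refl | yes refl = ⊥-elim (neq refl)
... | no  _   | yes _    | no _     = refl
... | no  _   | no _     | _        = refl

∑-perms-δ : ∀ {n} {x : Perm n} → IsPerm x → (g : Perm n → ℚ) →
            ∑[ w ∈ perms n ] (if does (x ≟ₚ w) then g w else 0ℚ) ≡ g x
∑-perms-δ {zero} {[]} _ g = ℚ.+-identityʳ (g [])
∑-perms-δ {suc n} x-perm g with isPerm⇒insert₀ x-perm
... | p₀ , j₀ , p₀-perm , refl = begin
  ∑[ w ∈ perms (suc n) ] δ w
    ≡⟨ ∑-perms-suc δ ⟩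
  ∑[ p ∈ perms n ] ∑[ j ∈ allFin (suc n) ] δ (insert₀ p j)
    ≡⟨ ∑-cong (perms n) (λ p → ∑-cong (allFin (suc n)) λ j →
         trans (cong (λ b → if b then g (insert₀ p j) else 0ℚ) (insert₀-≟ p₀ p j₀ j)) (if-∧ (does (j₀ Fin.≟ j)) (does (p₀ ≟ₚ p)) (g (insert₀ p j)))) ⟩
  ∑[ p ∈ perms n ] ∑[ j ∈ allFin (suc n) ] (if does (j₀ Fin.≟ j) then (if does (p₀ ≟ₚ p) then g (insert₀ p j) else 0ℚ) else 0ℚ)
    ≡⟨ ∑-cong (perms n) (λ p → ∑-allFin-δ j₀ _) ⟩
  ∑[ p ∈ perms n ] (if does (p₀ ≟ₚ p) then g (insert₀ p j₀) else 0ℚ)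
    ≡⟨ ∑-perms-δ p₀-perm (λ p → g (insert₀ p j₀)) ⟩
  g (insert₀ p₀ j₀)
    ∎
  where
  open ≡-Reasoning
  δ : Perm (suc n) → ℚ
  δ w = if does (insert₀ p₀ j₀ ≟ₚ w) then g w else 0ℚ

-- Inversions and the sign

iverson : Bool → ℕ
iverson b = if b then 1 else 0

countBelow : ℕ → List ℕ → ℕ
countBelow x L = List.length (List.filter (_<? x) L)

invᵥ : ∀ {k} → Vec ℕ k → ℕ
invᵥ V = invL (toList V)

countBelow-∷ : ∀ y x L → countBelow y (x ∷ L) ≡ iverson (does (x <? y)) ℕ.+ countBelow y L
countBelow-∷ y x L with x ℕ.<ᵇ y
... | true  = refl
... | false = refl

countBelow-insertAt : ∀ {k} y (V : Vec ℕ k) j x → countBelow y (toList (insertAt V j x)) ≡ countBelow y (x ∷ toList V)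
countBelow-insertAt y V       zero    x = refl
countBelow-insertAt y (z ∷ V) (suc j) x = begin
  countBelow y (z ∷ toList (insertAt V j x))                              ≡⟨ countBelow-∷ y z _ ⟩
  iverson (does (z <? y)) ℕ.+ countBelow y (toList (insertAt V j x))      ≡⟨ cong (iverson (does (z <? y)) ℕ.+_) (trans (countBelow-insertAt y V j x) (countBelow-∷ y x _)) ⟩
  iverson (does (z <? y)) ℕ.+ (iverson (does (x <? y)) ℕ.+ countBelow y (toList V))  ≡⟨ x∙yz≈y∙xz (iverson (does (z <? y))) (iverson (does (x <? y))) (countBelow y (toList V)) ⟩
  iverson (does (x <? y)) ℕ.+ (iverson (does (z <? y)) ℕ.+ countBelow y (toList V))  ≡⟨ cong (iverson (does (x <? y)) ℕ.+_) (countBelow-∷ y z _) ⟨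
  iverson (does (x <? y)) ℕ.+ countBelow y (z ∷ toList V)                 ≡⟨ countBelow-∷ y x _ ⟨
  countBelow y (x ∷ z ∷ toList V)                                         ∎
  where open ≡-Reasoning

_≤*_ : ∀ {k} → ℕ → Vec ℕ k → Set
b ≤* z = ∀ i → b ≤ lookup z i

countBelow-≤ : ∀ {k} m (V : Vec ℕ k) → m ≤* V → countBelow m (toList V) ≡ 0
countBelow-≤ m []      _      = refl
countBelow-≤ m (x ∷ V) m≤V = trans (countBelow-∷ m x (toList V))
  (cong₂ ℕ._+_ (cong iverson (dec-false (x <? m) (ℕ.≤⇒≯ (m≤V zero)))) (countBelow-≤ m V (m≤V ∘ suc)))

countBelow-map-suc : ∀ x L → countBelow (suc x) (List.map suc L) ≡ countBelow x L
countBelow-map-suc x []      = refl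
countBelow-map-suc x (y ∷ L) = trans (countBelow-∷ (suc x) (suc y) _)
  (trans (cong (iverson (does (y <? x)) ℕ.+_) (countBelow-map-suc x L)) (sym (countBelow-∷ x y L)))

invL-map-suc : ∀ L → invL (List.map suc L) ≡ invL L
invL-map-suc []      = refl
invL-map-suc (x ∷ L) = cong₂ ℕ._+_ (countBelow-map-suc x L) (invL-map-suc L)

aboveBefore : ∀ {k} → Fin (suc k) → ℕ → Vec ℕ k → Bool
aboveBefore zero    m V       = true
aboveBefore (suc j) m (x ∷ V) = does (m <? x) ∧ aboveBefore j m V

-- Inserting a minimal value m after a prefix lying strictly above m creates exactly one inversion per prefix entry.
invᵥ-insertAt-min : ∀ {k} (V : Vec ℕ k) j m → m ≤* V → aboveBefore j m V ≡ true →
                    invᵥ (insertAt V j m) ≡ toℕ j ℕ.+ invᵥ V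
invᵥ-insertAt-min V       zero    m m≤V _     = cong (ℕ._+ invᵥ V) (countBelow-≤ m V m≤V)
invᵥ-insertAt-min (x ∷ V) (suc j) m m≤V above with ∧-true {does (m <? x)} above
... | m<x , above′ = begin
  countBelow x (toList (insertAt V j m)) ℕ.+ invᵥ (insertAt V j m)
    ≡⟨ cong₂ ℕ._+_ (trans (countBelow-insertAt x V j m) (countBelow-∷ x m (toList V))) (invᵥ-insertAt-min V j m (m≤V ∘ suc) above′) ⟩
  (iverson (does (m <? x)) ℕ.+ countBelow x (toList V)) ℕ.+ (toℕ j ℕ.+ invᵥ V)
    ≡⟨ cong (λ b → (iverson b ℕ.+ countBelow x (toList V)) ℕ.+ (toℕ j ℕ.+ invᵥ V)) m<x ⟩
  suc (countBelow x (toList V) ℕ.+ (toℕ j ℕ.+ invᵥ V))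
    ≡⟨ cong suc (x∙yz≈y∙xz (countBelow x (toList V)) (toℕ j) (invᵥ V)) ⟩
  suc (toℕ j ℕ.+ (countBelow x (toList V) ℕ.+ invᵥ V))
    ∎
  where open ≡-Reasoning

aboveBefore-map-suc : ∀ {k} (j : Fin (suc k)) (W : Vec ℕ k) → aboveBefore j 0 (Vec.map suc W) ≡ true
aboveBefore-map-suc zero    W       = refl
aboveBefore-map-suc (suc j) (x ∷ W) = aboveBefore-map-suc j W

inversions-insert₀ : ∀ {n} (p : Perm n) j → inversions (insert₀ p j) ≡ toℕ j ℕ.+ inversions p
inversions-insert₀ p j = begin
  invᵥ (Vec.map toℕ (insertAt (Vec.map suc p) j zero))
    ≡⟨ cong invᵥ (trans (Vec.map-insertAt toℕ zero (Vec.map suc p) j) (cong (λ v → insertAt v j 0) (toℕ∘suc≡suc∘toℕ p))) ⟩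
  invᵥ (insertAt (Vec.map suc (Vec.map toℕ p)) j 0)
    ≡⟨ invᵥ-insertAt-min _ j 0 (λ _ → z≤n) (aboveBefore-map-suc j (Vec.map toℕ p)) ⟩
  toℕ j ℕ.+ invL (toList (Vec.map suc (Vec.map toℕ p)))
    ≡⟨ cong (λ L → toℕ j ℕ.+ invL L) (Vec.toList-map suc (Vec.map toℕ p)) ⟩
  toℕ j ℕ.+ invL (List.map suc (toList (Vec.map toℕ p)))
    ≡⟨ cong (toℕ j ℕ.+_) (invL-map-suc (toList (Vec.map toℕ p))) ⟩
  toℕ j ℕ.+ inversions p
    ∎
  where
  open ≡-Reasoning
  toℕ∘suc≡suc∘toℕ : ∀ {n k} (v : Vec (Fin n) k) → Vec.map toℕ (Vec.map Fin.suc v) ≡ Vec.map suc (Vec.map toℕ v)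
  toℕ∘suc≡suc∘toℕ v = trans (sym (Vec.map-∘ toℕ Fin.suc v)) (Vec.map-∘ suc toℕ v)

sgn : ∀ {n} → Perm n → ℚ
sgn w = [-1]^ inversions w

identity-suc : ∀ n → identity (suc n) ≡ insert₀ (identity n) zero
identity-suc n = cong (zero ∷_) (Vec.tabulate-∘ suc id)

sgn-identity : ∀ n → sgn (identity n) ≡ 1ℚ
sgn-identity zero    = refl
sgn-identity (suc n) = trans (cong (λ w → [-1]^ inversions w) (identity-suc n))
                             (trans (cong [-1]^_ (inversions-insert₀ (identity n) zero)) (sgn-identity n))

[-1]^-iverson-flip : ∀ t y → t ≢ y → [-1]^ iverson (does (t <? y)) ≡ - [-1]^ iverson (does (y <? t))
[-1]^-iverson-flip t y t≢y with ℕ.<-cmp t y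
... | tri< t<y _ y≮t rewrite dec-true (t <? y) t<y | dec-false (y <? t) y≮t = refl
... | tri≈ _ t≡y _   = ⊥-elim (t≢y t≡y)
... | tri> t≮y _ y<t rewrite dec-false (t <? y) t≮y | dec-true (y <? t) y<t = refl

[-1]^-countBelow-∷ : ∀ y x L → [-1]^ countBelow y (x ∷ L) ≡ [-1]^ iverson (does (x <? y)) * [-1]^ countBelow y L
[-1]^-countBelow-∷ y x L = trans (cong [-1]^_ (countBelow-∷ y x L)) ([-1]^-+ (iverson (does (x <? y))) _)

[-1]^-invᵥ-∷ : ∀ {k} x (V : Vec ℕ k) → [-1]^ invᵥ (x ∷ V) ≡ [-1]^ countBelow x (toList V) * [-1]^ invᵥ V
[-1]^-invᵥ-∷ x V = [-1]^-+ (countBelow x (toList V)) (invᵥ V)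

-- Moving a new entry t from the front to position j flips the relative order of t with the j entries it passes.
[-1]^-invᵥ-insertAt : ∀ {k} (V : Vec ℕ k) j t → (∀ i → lookup V i ≢ t) →
                      [-1]^ invᵥ (insertAt V j t) ≡ [-1]^ invᵥ V * ([-1]^ toℕ j * [-1]^ countBelow t (toList V))
[-1]^-invᵥ-insertAt V zero t _ = trans ([-1]^-invᵥ-∷ t V) (solve 2 (λ c i → c :* i := i :* (con 1ℚ :* c)) refl ([-1]^ countBelow t (toList V)) ([-1]^ invᵥ V))
  where open +-*-Solver
[-1]^-invᵥ-insertAt (y ∷ V) (suc j) t V≢t = begin
  [-1]^ invᵥ (y ∷ insertAt V j t)
    ≡⟨ [-1]^-invᵥ-∷ y (insertAt V j t) ⟩
  [-1]^ countBelow y (toList (insertAt V j t)) * [-1]^ invᵥ (insertAt V j t)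
    ≡⟨ cong₂ _*_ (trans (cong [-1]^_ (countBelow-insertAt y V j t)) ([-1]^-countBelow-∷ y t (toList V)))
                 ([-1]^-invᵥ-insertAt V j t (V≢t ∘ suc)) ⟩
  ([-1]^ iverson (does (t <? y)) * b) * (c * (d * e))
    ≡⟨ cong (λ s → (s * b) * (c * (d * e))) ([-1]^-iverson-flip t y (λ t≡y → V≢t zero (sym t≡y))) ⟩
  (- a * b) * (c * (d * e))
    ≡⟨ solve 5 (λ a b c d e → (:- a :* b) :* (c :* (d :* e)) := (b :* c) :* (:- d :* (a :* e))) refl a b c d e ⟩
  (b * c) * (- d * (a * e))
    ≡⟨ cong₂ (λ s r → s * (- d * r)) ([-1]^-invᵥ-∷ y V) ([-1]^-countBelow-∷ t y (toList V)) ⟨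
  [-1]^ invᵥ (y ∷ V) * ([-1]^ toℕ (suc j) * [-1]^ countBelow t (y ∷ toList V))
    ∎
  where
  open ≡-Reasoning
  open +-*-Solver
  a b c d e : ℚ
  a = [-1]^ iverson (does (y <? t))
  b = [-1]^ countBelow y (toList V)
  c = [-1]^ invᵥ V
  d = [-1]^ toℕ j
  e = [-1]^ countBelow t (toList V)

map-lookup-insert₀ : ∀ {n} (x : A) (T : Vec A n) (p : Perm n) j →
                     Vec.map (lookup (x ∷ T)) (insert₀ p j) ≡ insertAt (Vec.map (lookup T) p) j x
map-lookup-insert₀ x T p j = trans (Vec.map-insertAt (lookup (x ∷ T)) zero (Vec.map suc p) j)
                                   (cong (λ v → insertAt v j x) (sym (Vec.map-∘ (lookup (x ∷ T)) suc p)))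

countBelow-map-lookup : ∀ {n} (T : Vec ℕ n) {u : Perm n} → IsPerm u → ∀ t →
                        countBelow t (toList (Vec.map (lookup T) u)) ≡ countBelow t (toList T)
countBelow-map-lookup [] {[]} _ t = refl
countBelow-map-lookup (x ∷ T) u-perm t with isPerm⇒insert₀ u-perm
... | p , j , p-perm , refl = begin
  countBelow t (toList (Vec.map (lookup (x ∷ T)) (insert₀ p j)))           ≡⟨ cong (countBelow t ∘ toList) (map-lookup-insert₀ x T p j) ⟩
  countBelow t (toList (insertAt (Vec.map (lookup T) p) j x))              ≡⟨ countBelow-insertAt t _ j x ⟩
  countBelow t (x ∷ toList (Vec.map (lookup T) p))                         ≡⟨ countBelow-∷ t x _ ⟩
  iverson (does (x <? t)) ℕ.+ countBelow t (toList (Vec.map (lookup T) p)) ≡⟨ cong (iverson (does (x <? t)) ℕ.+_) (countBelow-map-lookup T p-perm t) ⟩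
  iverson (does (x <? t)) ℕ.+ countBelow t (toList T)                      ≡⟨ countBelow-∷ t x _ ⟨
  countBelow t (x ∷ toList T)                                              ∎
  where open ≡-Reasoning

[-1]^-invᵥ-map-lookup : ∀ {n} (T : Vec ℕ n) → (∀ i j → lookup T i ≡ lookup T j → i ≡ j) →
                        ∀ {u : Perm n} → IsPerm u → [-1]^ invᵥ (Vec.map (lookup T) u) ≡ [-1]^ invᵥ T * sgn u
[-1]^-invᵥ-map-lookup [] _ {[]} _ = refl
[-1]^-invᵥ-map-lookup (x ∷ T) T-inj u-perm with isPerm⇒insert₀ u-perm
... | p , j , p-perm , refl = begin
  [-1]^ invᵥ (Vec.map (lookup (x ∷ T)) (insert₀ p j))
    ≡⟨ cong (λ v → [-1]^ invᵥ v) (map-lookup-insert₀ x T p j) ⟩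
  [-1]^ invᵥ (insertAt (Vec.map (lookup T) p) j x)
    ≡⟨ [-1]^-invᵥ-insertAt _ j x x∉Tp ⟩
  [-1]^ invᵥ (Vec.map (lookup T) p) * ([-1]^ toℕ j * [-1]^ countBelow x (toList (Vec.map (lookup T) p)))
    ≡⟨ cong₂ (λ s c → s * ([-1]^ toℕ j * [-1]^ c)) ([-1]^-invᵥ-map-lookup T (λ i k eq → Fin.suc-injective (T-inj (suc i) (suc k) eq)) p-perm)
             (countBelow-map-lookup T p-perm x) ⟩
  ([-1]^ invᵥ T * sgn p) * ([-1]^ toℕ j * [-1]^ countBelow x (toList T))
    ≡⟨ solve 4 (λ i s d c → (i :* s) :* (d :* c) := (c :* i) :* (d :* s)) refl
               ([-1]^ invᵥ T) (sgn p) ([-1]^ toℕ j) ([-1]^ countBelow x (toList T)) ⟩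
  ([-1]^ countBelow x (toList T) * [-1]^ invᵥ T) * ([-1]^ toℕ j * sgn p)
    ≡⟨ cong₂ _*_ ([-1]^-invᵥ-∷ x T) (trans (cong [-1]^_ (inversions-insert₀ p j)) ([-1]^-+ (toℕ j) (inversions p))) ⟨
  [-1]^ invᵥ (x ∷ T) * sgn (insert₀ p j)
    ∎
  where
  open ≡-Reasoning
  open +-*-Solver
  x∉Tp : ∀ i → lookup (Vec.map (lookup T) p) i ≢ x
  x∉Tp i eq with () ← T-inj (suc (lookup p i)) zero (trans (sym (Vec.lookup-map i (lookup T) p)) eq)

sgn-∘ₚ : ∀ {n} {v u : Perm n} → IsPerm v → IsPerm u → sgn (v ∘ₚ u) ≡ sgn v * sgn u
sgn-∘ₚ {v = v} {u} v-perm u-perm =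
  trans (cong (λ V → [-1]^ invᵥ V) toℕ-∘ₚ) ([-1]^-invᵥ-map-lookup (Vec.map toℕ v) toℕv-inj u-perm)
  where
  toℕ-∘ₚ : Vec.map toℕ (v ∘ₚ u) ≡ Vec.map (lookup (Vec.map toℕ v)) u
  toℕ-∘ₚ = trans (sym (Vec.map-∘ toℕ (lookup v) u)) (Vec.map-cong (λ i → sym (Vec.lookup-map i toℕ v)) u)
  toℕv-inj : ∀ i j → lookup (Vec.map toℕ v) i ≡ lookup (Vec.map toℕ v) j → i ≡ j
  toℕv-inj i j eq = injective v-perm i j (Fin.toℕ-injective (trans (sym (Vec.lookup-map i toℕ v)) (trans eq (Vec.lookup-map j toℕ v))))

-- Descents of inverses

inverse-insert₀ : ∀ {n} {p : Perm n} → IsPerm p → ∀ j → inverse (insert₀ p j) ≡ j ∷ Vec.map (punchIn j) (inverse p)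
inverse-insert₀ {p = p} p-perm j = lookup-ext λ where
    zero    → lookup-inverse (insert₀ p j) ins-perm (lookup-insert₀-at p j)
    (suc y) → trans (lookup-inverse (insert₀ p j) ins-perm (trans (lookup-insert₀-punchIn p j _) (cong suc (lookup-lookup-inverse p p-perm y))))
                    (sym (Vec.lookup-map y (punchIn j) (inverse p)))
  where
  ins-perm : IsPerm (insert₀ p j)
  ins-perm = insert₀-isPerm p-perm j

punchIn-<-pivot : ∀ {n} (j : Fin (suc n)) (q : Fin n) → does (toℕ (punchIn j q) <? toℕ j) ≡ does (toℕ q <? toℕ j)
punchIn-<-pivot zero    q       = refl
punchIn-<-pivot (suc j) zero    = refl
punchIn-<-pivot (suc j) (suc q) = punchIn-<-pivot j q

punchIn-<-mono : ∀ {n} (j : Fin (suc n)) (a b : Fin n) → does (toℕ (punchIn j b) <? toℕ (punchIn j a)) ≡ does (toℕ b <? toℕ a)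
punchIn-<-mono j a b = does-⇔
  (λ jb<ja → ℕ.≰⇒> (λ a≤b → ℕ.<⇒≱ jb<ja (Fin.punchIn-mono-≤ j a b a≤b)))
  (λ b<a → ℕ.≰⇒> (λ ja≤jb → ℕ.<⇒≱ b<a (Fin.punchIn-cancel-≤ j a b ja≤jb)))
  (toℕ (punchIn j b) <? toℕ (punchIn j a)) (toℕ b <? toℕ a)

headBelow : ∀ {n k} → Vec (Fin n) k → Fin (suc n) → Bool
headBelow []      j = false
headBelow (q ∷ _) j = does (toℕ q <? toℕ j)

desL-map-punchIn : ∀ {n k} (j : Fin (suc n)) (q : Vec (Fin n) k) →
                   desL (toList (Vec.map toℕ (Vec.map (punchIn j) q))) ≡ desL (toList (Vec.map toℕ q))
desL-map-punchIn j []          = refl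
desL-map-punchIn j (a ∷ [])    = refl
desL-map-punchIn j (a ∷ b ∷ q) = cong₂ ℕ._+_ (cong iverson (punchIn-<-mono j a b)) (desL-map-punchIn j (b ∷ q))

des-∷-map-punchIn : ∀ {n} (j : Fin (suc n)) (q : Vec (Fin n) n) →
                    des (j ∷ Vec.map (punchIn j) q) ≡ iverson (headBelow q j) ℕ.+ des q
des-∷-map-punchIn j []      = refl
des-∷-map-punchIn j (a ∷ q) = cong₂ ℕ._+_ (cong iverson (punchIn-<-pivot j a)) (desL-map-punchIn j (a ∷ q))

des-inverse-insert₀ : ∀ {n} {p : Perm n} → IsPerm p → ∀ j →
                      des (inverse (insert₀ p j)) ≡ iverson (headBelow (inverse p) j) ℕ.+ des (inverse p)
des-inverse-insert₀ {p = p} p-perm j = trans (cong des (inverse-insert₀ p-perm j)) (des-∷-map-punchIn j (inverse p))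

desL-≤ : ∀ x L → desL (x ∷ L) ≤ List.length L
desL-≤ x []      = z≤n
desL-≤ x (y ∷ L) = ℕ.+-mono-≤ (iverson≤1 (does (y <? x))) (desL-≤ y L)
  where
  iverson≤1 : ∀ b → iverson b ≤ 1
  iverson≤1 true  = ℕ.≤-refl
  iverson≤1 false = z≤n

des-≤ : ∀ {k} (v : Perm (suc k)) → des v ≤ k
des-≤ (q ∷ v) = subst (desL (toℕ q ∷ toList (Vec.map toℕ v)) ≤_) (Vec.length-toList (Vec.map toℕ v)) (desL-≤ (toℕ q) (toList (Vec.map toℕ v)))

shuffleCount : ∀ {n} → ℕ → Perm n → ℕ
shuffleCount {n} c p = (n ℕ.+ c ∸ des (inverse p) ∸ 1) C n

∸-∸-1 : ∀ x d → x ∸ d ∸ 1 ≡ x ∸ suc d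
∸-∸-1 x d = trans (ℕ.∸-+-assoc x d 1) (cong (x ∸_) (ℕ.+-comm d 1))

shuffleCount-insert₀ : ∀ {n} c (p : Perm n) j →
                       shuffleCount c (insert₀ p j) ≡ ((n ∸ des (inverse (insert₀ p j))) ℕ.+ c) C suc n
shuffleCount-insert₀ {n} c p j = cong (_C suc n) (trans (∸-∸-1 (suc n ℕ.+ c) D) (ℕ.+-∸-comm c (des-≤ (inverse (insert₀ p j)))))
  where
  D : ℕ
  D = des (inverse (insert₀ p j))

-- Words and their standardization

range : ℕ → ℕ → List ℕ
range b zero    = []
range b (suc k) = b ∷ range (suc b) k

range-≥ : ∀ k b → All (b ≤_) (range b k)
range-≥ zero    b = []
range-≥ (suc k) b = ℕ.≤-refl ∷ All.map (ℕ.≤-trans (ℕ.n≤1+n b)) (range-≥ k (suc b))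

range-< : ∀ k b → All (_< b ℕ.+ k) (range b k)
range-< zero    b = []
range-< (suc k) b = ℕ.m<m+n b (s≤s z≤n) ∷ subst (λ c → All (_< c) (range (suc b) k)) (sym (ℕ.+-suc b k)) (range-< k (suc b))

length-range : ∀ k b → List.length (range b k) ≡ k
length-range zero    b = refl
length-range (suc k) b = cong suc (length-range k (suc b))

-- Off-diagonal pairs cancel since swapping x and y flips the sign, so only the k diagonal terms survive.
∑-range-pairs : ∀ k b (h : ℕ → ℚ) → (∀ x → h x * h x ≡ 1ℚ) →
                ∑[ x ∈ range b k ] ∑[ y ∈ range b k ] [-1]^ iverson (does (y <? x)) * (h x * h y) ≡ fromℕ k
∑-range-pairs zero    b h h²≡1 = refl
∑-range-pairs (suc k) b h h²≡1 = begin
  (t b b + ∑ R (t b)) + (∑[ x ∈ R ] (t x b + ∑ R (t x)))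
    ≡⟨ cong ((t b b + ∑ R (t b)) +_) (∑-+ R (λ x → t x b) (λ x → ∑ R (t x))) ⟩
  (t b b + ∑ R (t b)) + (∑ R (λ x → t x b) + ∑ R (λ x → ∑ R (t x)))
    ≡⟨ solve 4 (λ p q r s → (p :+ q) :+ (r :+ s) := p :+ ((q :+ r) :+ s)) refl (t b b) (∑ R (t b)) (∑ R (λ x → t x b)) (∑ R (λ x → ∑ R (t x))) ⟩
  t b b + ((∑ R (t b) + ∑ R (λ x → t x b)) + ∑ R (λ x → ∑ R (t x)))
    ≡⟨ cong₂ (λ d c → d + (c + ∑ R (λ x → ∑ R (t x)))) diagonal cancel ⟩
  1ℚ + (0ℚ + ∑ R (λ x → ∑ R (t x)))
    ≡⟨ cong (1ℚ +_) (trans (ℚ.+-identityˡ _) (∑-range-pairs k (suc b) h h²≡1)) ⟩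
  1ℚ + fromℕ k
    ≡⟨ fromℕ-+ 1 k ⟨
  fromℕ (suc k)
    ∎
  where
  open ≡-Reasoning
  open +-*-Solver
  R : List ℕ
  R = range (suc b) k
  t : ℕ → ℕ → ℚ
  t x y = [-1]^ iverson (does (y <? x)) * (h x * h y)
  diagonal : t b b ≡ 1ℚ
  diagonal = trans (cong (λ c → [-1]^ iverson c * (h b * h b)) (dec-false (b <? b) (ℕ.n≮n b))) (trans (ℚ.*-identityˡ _) (h²≡1 b))
  cancel : ∑ R (t b) + ∑ R (λ x → t x b) ≡ 0ℚ
  cancel = trans (sym (∑-+ R (t b) (λ x → t x b))) (trans (∑-cong-All R (range-≥ k (suc b)) opposite) (∑-zero R))
    where
    opposite : ∀ y → b < y → t b y + t y b ≡ 0ℚ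
    opposite y b<y = trans (cong₂ (λ c d → [-1]^ iverson c * (h b * h y) + [-1]^ iverson d * (h y * h b))
                                  (dec-false (y <? b) (ℕ.<⇒≯ b<y)) (dec-true (b <? y) b<y))
                           (solve 2 (λ u v → con 1ℚ :* (u :* v) :+ (:- con 1ℚ) :* (v :* u) := con 0ℚ) refl (h b) (h y))

_≤*ᵇ_ : ∀ {k} → ℕ → Vec ℕ k → Bool
b ≤*ᵇ []      = true
b ≤*ᵇ (y ∷ z) = does (b ≤? y) ∧ (b ≤*ᵇ z)

≤*⇒≤*ᵇ : ∀ {k} {b} (z : Vec ℕ k) → b ≤* z → b ≤*ᵇ z ≡ true
≤*⇒≤*ᵇ         []      _     = refl
≤*⇒≤*ᵇ {b = b} (y ∷ z) b≤*yz = cong₂ _∧_ (dec-true (b ≤? y) (b≤*yz zero)) (≤*⇒≤*ᵇ z (b≤*yz ∘ suc))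

≤*-∷ : ∀ {k} {b x} {z : Vec ℕ k} → b ≤ x → b ≤* z → b ≤* (x ∷ z)
≤*-∷ b≤x b≤*z zero    = b≤x
≤*-∷ b≤x b≤*z (suc i) = b≤*z i

∧-left-comm : ∀ b c d → b ∧ (c ∧ d) ≡ c ∧ (b ∧ d)
∧-left-comm true  c     d = refl
∧-left-comm false true  d = refl
∧-left-comm false false d = refl

≤*ᵇ-insertAt : ∀ {k} x (z : Vec ℕ k) j m → x ≤*ᵇ insertAt z j m ≡ does (x ≤? m) ∧ (x ≤*ᵇ z)
≤*ᵇ-insertAt x z       zero    m = refl
≤*ᵇ-insertAt x (w ∷ z) (suc j) m = trans (cong (does (x ≤? w) ∧_) (≤*ᵇ-insertAt x z j m)) (∧-left-comm (does (x ≤? w)) (does (x ≤? m)) (x ≤*ᵇ z))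

≤*ᵇ-insertAt-min : ∀ {k} x (z : Vec ℕ k) j m → m ≤* z → x ≤*ᵇ insertAt z j m ≡ not (does (m <? x))
≤*ᵇ-insertAt-min x z j m m≤*z with x ≤? m in eq
... | yes x≤m = begin
  x ≤*ᵇ insertAt z j m         ≡⟨ ≤*ᵇ-insertAt x z j m ⟩
  does (x ≤? m) ∧ (x ≤*ᵇ z)    ≡⟨ cong₂ _∧_ (cong does eq) (≤*⇒≤*ᵇ z (λ i → ℕ.≤-trans x≤m (m≤*z i))) ⟩
  true                         ≡⟨ cong not (dec-false (m <? x) (ℕ.≤⇒≯ x≤m)) ⟨
  not (does (m <? x))          ∎
  where open ≡-Reasoning
... | no x≰m = begin
  x ≤*ᵇ insertAt z j m         ≡⟨ ≤*ᵇ-insertAt x z j m ⟩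
  does (x ≤? m) ∧ (x ≤*ᵇ z)    ≡⟨ cong (_∧ (x ≤*ᵇ z)) (cong does eq) ⟩
  false                        ≡⟨ cong not (dec-true (m <? x) (ℕ.≰⇒> x≰m)) ⟨
  not (does (m <? x))          ∎
  where open ≡-Reasoning

firstMin : ∀ {n} → Vec ℕ (suc n) → Fin (suc n)
firstMin {zero}  (x ∷ []) = zero
firstMin {suc n} (x ∷ w)  = if does (x ≤? lookup w (firstMin w)) then zero else suc (firstMin w)

-- The standardization of a word: its letters are ranked by value, ties broken from left to right.
standardize : ∀ {n} → Vec ℕ n → Perm n
standardize {zero}  []  = []
standardize {suc n} z   = insert₀ (standardize (removeAt z (firstMin z))) (firstMin z)

≤ᵇ-true⇒≤ : ∀ {x y} → (x ℕ.≤ᵇ y) ≡ true → x ≤ y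
≤ᵇ-true⇒≤ {x} {y} eq = ℕ.≤ᵇ⇒≤ x y (subst T (sym eq) _)

≤ᵇ-false⇒> : ∀ {x y} → (x ℕ.≤ᵇ y) ≡ false → y < x
≤ᵇ-false⇒> eq = ℕ.≰⇒> (λ x≤y → subst T eq (ℕ.≤⇒≤ᵇ x≤y))

firstMin-≤ : ∀ {n} (z : Vec ℕ (suc n)) → lookup z (firstMin z) ≤* z
firstMin-≤ {zero}  (x ∷ []) zero = ℕ.≤-refl
firstMin-≤ {suc n} (x ∷ w) i with x ℕ.≤ᵇ lookup w (firstMin w) in eq
firstMin-≤ {suc n} (x ∷ w) zero    | true  = ℕ.≤-refl
firstMin-≤ {suc n} (x ∷ w) (suc i) | true  = ℕ.≤-trans (≤ᵇ-true⇒≤ eq) (firstMin-≤ w i)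
firstMin-≤ {suc n} (x ∷ w) zero    | false = ℕ.<⇒≤ (≤ᵇ-false⇒> eq)
firstMin-≤ {suc n} (x ∷ w) (suc i) | false = firstMin-≤ w i

firstMin-≤* : ∀ {n} (z : Vec ℕ (suc n)) → lookup z (firstMin z) ≤* removeAt z (firstMin z)
firstMin-≤* z i = subst (lookup z (firstMin z) ≤_) (sym (lookup-removeAt z (firstMin z) i)) (firstMin-≤ z _)

aboveBefore-firstMin : ∀ {n} (z : Vec ℕ (suc n)) → aboveBefore (firstMin z) (lookup z (firstMin z)) (removeAt z (firstMin z)) ≡ true
aboveBefore-firstMin {zero}  (x ∷ [])     = refl
aboveBefore-firstMin {suc n} (x ∷ y ∷ ys) with x ℕ.≤ᵇ lookup (y ∷ ys) (firstMin (y ∷ ys)) in eq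
... | true  = refl
... | false = cong₂ _∧_ (dec-true (lookup (y ∷ ys) (firstMin (y ∷ ys)) <? x) (≤ᵇ-false⇒> eq)) (aboveBefore-firstMin (y ∷ ys))

firstMin-insertAt : ∀ {n} (z : Vec ℕ n) j m → m ≤* z → aboveBefore j m z ≡ true → firstMin (insertAt z j m) ≡ j
firstMin-insertAt []      zero m _ _ = refl
firstMin-insertAt (y ∷ z) zero m m≤*yz _ with m ℕ.≤ᵇ lookup (y ∷ z) (firstMin (y ∷ z)) in eq
... | true  = refl
... | false = ⊥-elim (ℕ.<⇒≱ (≤ᵇ-false⇒> eq) (m≤*yz (firstMin (y ∷ z))))
firstMin-insertAt {suc n} (y ∷ z) (suc j) m m≤*yz above with ∧-true {does (m <? y)} above
... | m<y , above′ with y ℕ.≤ᵇ lookup (insertAt z j m) (firstMin (insertAt z j m)) in eq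
...   | false = cong suc (firstMin-insertAt z j m (m≤*yz ∘ suc) above′)
...   | true  = ⊥-elim (ℕ.<⇒≱ (does-true (m <? y) m<y) (subst (y ≤_) min≡m (≤ᵇ-true⇒≤ eq)))
  where
  min≡m : lookup (insertAt z j m) (firstMin (insertAt z j m)) ≡ m
  min≡m = trans (cong (lookup (insertAt z j m)) (firstMin-insertAt z j m (m≤*yz ∘ suc) above′)) (Vec.insertAt-lookup z j m)

standardize-insertAt : ∀ {n} (z : Vec ℕ n) j m → m ≤* z → aboveBefore j m z ≡ true →
                       standardize (insertAt z j m) ≡ insert₀ (standardize z) j
standardize-insertAt z j m m≤*z above rewrite firstMin-insertAt z j m m≤*z above =
  cong (λ r → insert₀ (standardize r) j) (Vec.removeAt-insertAt z j m)

standardize-isPerm : ∀ {n} (z : Vec ℕ n) → IsPerm (standardize z)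
standardize-isPerm {zero}  [] = record { injective = λ () ; surjective = λ () }
standardize-isPerm {suc n} z  = insert₀-isPerm (standardize-isPerm (removeAt z (firstMin z))) (firstMin z)

inversions-standardize : ∀ {n} (z : Vec ℕ n) → inversions (standardize z) ≡ invᵥ z
inversions-standardize {zero}  [] = refl
inversions-standardize {suc n} z  = begin
  inversions (insert₀ (standardize z′) k)          ≡⟨ inversions-insert₀ (standardize z′) k ⟩
  toℕ k ℕ.+ inversions (standardize z′)            ≡⟨ cong (toℕ k ℕ.+_) (inversions-standardize z′) ⟩
  toℕ k ℕ.+ invᵥ z′                                ≡⟨ invᵥ-insertAt-min z′ k (lookup z k) (firstMin-≤* z) (aboveBefore-firstMin z) ⟨
  invᵥ (insertAt z′ k (lookup z k))                ≡⟨ cong invᵥ (Vec.insertAt-removeAt z k) ⟩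
  invᵥ z                                           ∎
  where
  open ≡-Reasoning
  k : Fin (suc n)
  k = firstMin z
  z′ : Vec ℕ n
  z′ = removeAt z k

headBelow-inverse-standardize : ∀ {n} (z : Vec ℕ (suc n)) j → headBelow (inverse (standardize z)) j ≡ does (toℕ (firstMin z) <? toℕ j)
headBelow-inverse-standardize z j = cong (λ v → headBelow v j) (inverse-insert₀ (standardize-isPerm (removeAt z (firstMin z))) (firstMin z))

aboveBefore-<* : ∀ {n} j m (z : Vec ℕ n) → suc m ≤* z → aboveBefore j m z ≡ true
aboveBefore-<* zero    m z       _      = refl
aboveBefore-<* (suc j) m (x ∷ z) m<*xz = cong₂ _∧_ (dec-true (m <? x) (m<*xz zero)) (aboveBefore-<* j m z (m<*xz ∘ suc))

-- For a word z ≥ m, the entries before position j all exceed m iff m does not occur in z, or occurs first at or after j.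
aboveBefore-≡ : ∀ {n} (z : Vec ℕ n) j m → m ≤* z → aboveBefore j m z ≡ (suc m ≤*ᵇ z) ∨ not (headBelow (inverse (standardize z)) j)
aboveBefore-≡ {zero}  [] zero m _    = refl
aboveBefore-≡ {suc n} z  j    m m≤*z = trans (aboveBefore-≡-firstMin z j m m≤*z) (cong (λ c → (suc m ≤*ᵇ z) ∨ not c) (sym (headBelow-inverse-standardize z j)))
  where
  aboveBefore-≡-firstMin : ∀ {n} (z : Vec ℕ (suc n)) j m → m ≤* z → aboveBefore j m z ≡ (suc m ≤*ᵇ z) ∨ not (does (toℕ (firstMin z) <? toℕ j))
  aboveBefore-≡-firstMin z       zero    m _ = sym (Bool.∨-zeroʳ (suc m ≤*ᵇ z))
  aboveBefore-≡-firstMin {zero}  (x ∷ []) (suc zero) m _ = sym (Bool.∨-identityʳ _)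
  aboveBefore-≡-firstMin {suc n} (x ∷ w) (suc j) m m≤*xw with x ℕ.≤ᵇ lookup w (firstMin w) in eq
  ... | false = begin
    does (m <? x) ∧ aboveBefore j m w                                                ≡⟨ cong (_∧ aboveBefore j m w) (dec-true (m <? x) m<x) ⟩
    aboveBefore j m w                                                                ≡⟨ aboveBefore-≡-firstMin w j m (m≤*xw ∘ suc) ⟩
    (suc m ≤*ᵇ w) ∨ not (does (toℕ (firstMin w) <? toℕ j))                          ≡⟨ cong (λ c → (c ∧ (suc m ≤*ᵇ w)) ∨ not (does (toℕ (firstMin w) <? toℕ j))) (dec-true (suc m ≤? x) m<x) ⟨
    (does (suc m ≤? x) ∧ (suc m ≤*ᵇ w)) ∨ not (does (toℕ (firstMin w) <? toℕ j))   ∎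
    where
    open ≡-Reasoning
    m<x : m < x
    m<x = ℕ.≤-<-trans (m≤*xw (suc (firstMin w))) (≤ᵇ-false⇒> eq)
  ... | true with m <? x
  ...   | yes m<x = begin
    does (m <? x) ∧ aboveBefore j m w               ≡⟨ cong₂ _∧_ (dec-true (m <? x) m<x) (aboveBefore-<* j m w m<*w) ⟩
    true                                            ≡⟨ cong₂ _∧_ (dec-true (suc m ≤? x) m<x) (≤*⇒≤*ᵇ w m<*w) ⟨
    does (suc m ≤? x) ∧ (suc m ≤*ᵇ w)               ≡⟨ Bool.∨-identityʳ _ ⟨
    (does (suc m ≤? x) ∧ (suc m ≤*ᵇ w)) ∨ false     ∎
    where
    open ≡-Reasoning
    m<*w : suc m ≤* w
    m<*w i = ℕ.<-≤-trans m<x (ℕ.≤-trans (≤ᵇ-true⇒≤ eq) (firstMin-≤ w i))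
  ...   | no m≮x = begin
    does (m <? x) ∧ aboveBefore j m w               ≡⟨ cong (_∧ aboveBefore j m w) (dec-false (m <? x) m≮x) ⟩
    false                                           ≡⟨ cong (_∧ (suc m ≤*ᵇ w)) (dec-false (suc m ≤? x) m≮x) ⟨
    does (suc m ≤? x) ∧ (suc m ≤*ᵇ w)               ≡⟨ Bool.∨-identityʳ _ ⟨
    (does (suc m ≤? x) ∧ (suc m ≤*ᵇ w)) ∨ false     ∎
    where open ≡-Reasoning

module Words (a : ℕ) where

  letters : ℕ → List ℕ
  letters b = range b (a ∸ b)

  letters-≥ : ∀ b → All (b ≤_) (letters b)
  letters-≥ b = range-≥ (a ∸ b) b

  letters-< : ∀ b → All (_< a) (letters b)
  letters-< b with b ≤? a
  ... | yes b≤a = subst (λ c → All (_< c) (letters b)) (ℕ.m+[n∸m]≡n b≤a) (range-< (a ∸ b) b)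
  ... | no  b≰a = subst (All (_< a)) (sym (cong (range b) (ℕ.m≤n⇒m∸n≡0 (ℕ.<⇒≤ (ℕ.≰⇒> b≰a))))) []

  letters-suc : ∀ b → b < a → letters b ≡ b ∷ letters (suc b)
  letters-suc b b<a = cong (range b) (ℕ.+-∸-assoc 1 b<a)

  letters-empty : ∀ b → a ≤ b → letters b ≡ []
  letters-empty b a≤b = cong (range b) (ℕ.m≤n⇒m∸n≡0 a≤b)

  ∑-letters-from′ : ∀ d b (f : ℕ → ℚ) → ∑[ y ∈ letters b ] (if does (d ℕ.+ b ≤? y) then f y else 0ℚ) ≡ ∑ (letters (d ℕ.+ b)) f
  ∑-letters-from′ zero b f = ∑-cong-All (letters b) (letters-≥ b) (λ y b≤y → cong (λ c → if c then f y else 0ℚ) (dec-true (b ≤? y) b≤y))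
  ∑-letters-from′ (suc d) b f with b <? a
  ... | no  b≮a = trans (cong (λ L → ∑[ y ∈ L ] (if does (suc d ℕ.+ b ≤? y) then f y else 0ℚ)) (letters-empty b (ℕ.≮⇒≥ b≮a)))
                        (cong (λ L → ∑ L f) (sym (letters-empty (suc d ℕ.+ b) (ℕ.≤-trans (ℕ.≮⇒≥ b≮a) (ℕ.m≤n+m b (suc d))))))
  ... | yes b<a = begin
    ∑[ y ∈ letters b ] g y                   ≡⟨ cong (λ L → ∑ L g) (letters-suc b b<a) ⟩
    g b + (∑[ y ∈ letters (suc b) ] g y)     ≡⟨ cong (_+ ∑ (letters (suc b)) g) (cong (λ c → if c then f b else 0ℚ) (dec-false (suc d ℕ.+ b ≤? b) (ℕ.m+n≮n d b))) ⟩
    0ℚ + (∑[ y ∈ letters (suc b) ] g y)      ≡⟨ ℚ.+-identityˡ _ ⟩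
    ∑[ y ∈ letters (suc b) ] g y             ≡⟨ subst (λ c → ∑[ y ∈ letters (suc b) ] (if does (c ≤? y) then f y else 0ℚ) ≡ ∑ (letters c) f)
                                                      (ℕ.+-suc d b) (∑-letters-from′ d (suc b) f) ⟩
    ∑ (letters (suc d ℕ.+ b)) f              ∎
    where
    open ≡-Reasoning
    g : ℕ → ℚ
    g y = if does (suc d ℕ.+ b ≤? y) then f y else 0ℚ

  ∑-letters-from : ∀ {b x} → b ≤ x → (f : ℕ → ℚ) → ∑[ y ∈ letters b ] (if does (x ≤? y) then f y else 0ℚ) ≡ ∑ (letters x) f
  ∑-letters-from {b} {x} b≤x f = subst (λ c → ∑[ y ∈ letters b ] (if does (c ≤? y) then f y else 0ℚ) ≡ ∑ (letters c) f)
                                       (ℕ.m∸n+n≡m b≤x) (∑-letters-from′ (x ∸ b) b f)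

  words : ℕ → (n : ℕ) → List (Vec ℕ n)
  words b zero    = [] ∷ []
  words b (suc n) = concatMap (λ x → List.map (x ∷_) (words b n)) (letters b)

  ∑-words-suc : ∀ b n (G : Vec ℕ (suc n) → ℚ) → ∑ (words b (suc n)) G ≡ ∑[ x ∈ letters b ] ∑[ z ∈ words b n ] G (x ∷ z)
  ∑-words-suc b n G = trans (∑-concatMap _ (letters b) G) (∑-cong (letters b) (λ x → ∑-map (x ∷_) (words b n) G))

  words-≥ : ∀ b n → All (b ≤*_) (words b n)
  words-≥ b zero    = (λ ()) ∷ []
  words-≥ b (suc n) = All.concat⁺ (All.gmap⁺ (λ b≤x → All.gmap⁺ (≤*-∷ b≤x) (words-≥ b n)) (letters-≥ b))

  ∑-words-≤*ᵇ : ∀ {b x} → b ≤ x → ∀ n (H : Vec ℕ n → ℚ) →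
                ∑[ z ∈ words b n ] (if x ≤*ᵇ z then H z else 0ℚ) ≡ ∑ (words x n) H
  ∑-words-≤*ᵇ b≤x zero    H = refl
  ∑-words-≤*ᵇ {b} {x} b≤x (suc n) H = begin
    ∑[ z ∈ words b (suc n) ] (if x ≤*ᵇ z then H z else 0ℚ)
      ≡⟨ ∑-words-suc b n _ ⟩
    ∑[ y ∈ letters b ] ∑[ z ∈ words b n ] (if does (x ≤? y) ∧ (x ≤*ᵇ z) then H (y ∷ z) else 0ℚ)
      ≡⟨ ∑-cong (letters b) (λ y → trans (∑-cong (words b n) (λ z → if-∧ (does (x ≤? y)) _ _)) (∑-if (words b n) (does (x ≤? y)) _)) ⟩
    ∑[ y ∈ letters b ] (if does (x ≤? y) then ∑[ z ∈ words b n ] (if x ≤*ᵇ z then H (y ∷ z) else 0ℚ) else 0ℚ)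
      ≡⟨ ∑-cong (letters b) (λ y → cong (λ s → if does (x ≤? y) then s else 0ℚ) (∑-words-≤*ᵇ b≤x n (H ∘ (y ∷_)))) ⟩
    ∑[ y ∈ letters b ] (if does (x ≤? y) then ∑[ z ∈ words x n ] H (y ∷ z) else 0ℚ)
      ≡⟨ ∑-letters-from b≤x _ ⟩
    ∑[ y ∈ letters x ] ∑[ z ∈ words x n ] H (y ∷ z)
      ≡⟨ ∑-words-suc x n H ⟨
    ∑ (words x (suc n)) H
      ∎
    where open ≡-Reasoning

  withMinAt : ∀ {n} → (Vec ℕ (suc n) → ℚ) → ℕ → Fin (suc n) → Vec ℕ n → ℚ
  withMinAt G m j z = if aboveBefore j m z then G (insertAt z j m) else 0ℚ

  MinDecomposition : ℕ → Set
  MinDecomposition n = ∀ b (G : Vec ℕ (suc n) → ℚ) →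
    ∑ (words b (suc n)) G ≡ ∑[ m ∈ letters b ] ∑[ j ∈ allFin (suc n) ] ∑[ z ∈ words m n ] withMinAt G m j z

  ∑-letters-< : ∀ b (f : ℕ → ℕ → ℚ) →
                ∑[ x ∈ letters b ] ∑[ m ∈ letters b ] (if does (m <? x) then f x m else 0ℚ) ≡ ∑[ m ∈ letters b ] ∑[ x ∈ letters (suc m) ] f x m
  ∑-letters-< b f = trans (∑-comm (letters b) (letters b) _)
    (∑-cong-All (letters b) (letters-≥ b) (λ m b≤m → ∑-letters-from (ℕ.m≤n⇒m≤1+n b≤m) (λ x → f x m)))

  ∑-withMinAt-suc : ∀ {n} m j (G : Vec ℕ (suc (suc n)) → ℚ) →
    ∑[ z ∈ words m (suc n) ] withMinAt G m (suc j) z ≡ ∑[ x ∈ letters (suc m) ] ∑[ z ∈ words m n ] withMinAt (G ∘ (x ∷_)) m j z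
  ∑-withMinAt-suc {n} m j G = begin
    ∑[ z ∈ words m (suc n) ] withMinAt G m (suc j) z
      ≡⟨ ∑-words-suc m n _ ⟩
    ∑[ x ∈ letters m ] ∑[ z ∈ words m n ] (if does (m <? x) ∧ aboveBefore j m z then G (x ∷ insertAt z j m) else 0ℚ)
      ≡⟨ ∑-cong (letters m) (λ x → trans (∑-cong (words m n) (λ z → if-∧ (does (m <? x)) _ _)) (∑-if (words m n) (does (m <? x)) _)) ⟩
    ∑[ x ∈ letters m ] (if does (m <? x) then ∑[ z ∈ words m n ] withMinAt (G ∘ (x ∷_)) m j z else 0ℚ)
      ≡⟨ ∑-letters-from (ℕ.n≤1+n m) (λ x → ∑[ z ∈ words m n ] withMinAt (G ∘ (x ∷_)) m j z) ⟩
    ∑[ x ∈ letters (suc m) ] ∑[ z ∈ words m n ] withMinAt (G ∘ (x ∷_)) m j z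
      ∎
    where open ≡-Reasoning

  -- Either every later letter is at least x, so x is the first minimum, or the tail has its own first minimum m < x.
  ∑-words-split-head : ∀ {n} → MinDecomposition n → ∀ {b} x → b ≤ x → (G : Vec ℕ (suc (suc n)) → ℚ) →
    ∑[ z ∈ words b (suc n) ] G (x ∷ z) ≡
    (∑[ z ∈ words x (suc n) ] G (x ∷ z)) + (∑[ m ∈ letters b ] (if does (m <? x) then ∑[ j ∈ allFin (suc n) ] ∑[ z ∈ words m n ] withMinAt (G ∘ (x ∷_)) m j z else 0ℚ))
  ∑-words-split-head {n} decompose {b} x b≤x G = begin
    ∑[ z ∈ words b (suc n) ] H z
      ≡⟨ ∑-cong (words b (suc n)) (λ z → if-split (x ≤*ᵇ z) (H z)) ⟩
    ∑[ z ∈ words b (suc n) ] ((if x ≤*ᵇ z then H z else 0ℚ) + H′ z)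
      ≡⟨ ∑-+ (words b (suc n)) _ H′ ⟩
    (∑[ z ∈ words b (suc n) ] (if x ≤*ᵇ z then H z else 0ℚ)) + (∑[ z ∈ words b (suc n) ] H′ z)
      ≡⟨ cong₂ _+_ (∑-words-≤*ᵇ b≤x (suc n) H) (decompose b H′) ⟩
    (∑[ z ∈ words x (suc n) ] H z) + (∑[ m ∈ letters b ] ∑[ j ∈ allFin (suc n) ] ∑[ z ∈ words m n ] withMinAt H′ m j z)
      ≡⟨ cong (_+_ (∑ (words x (suc n)) H)) (∑-cong (letters b) λ m →
           trans (∑-cong (allFin (suc n)) (∑-withMinAt-H′ m)) (∑-if (allFin (suc n)) (does (m <? x)) _)) ⟩
    (∑[ z ∈ words x (suc n) ] H z) + (∑[ m ∈ letters b ] (if does (m <? x) then ∑[ j ∈ allFin (suc n) ] ∑[ z ∈ words m n ] withMinAt H m j z else 0ℚ))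
      ∎
    where
    open ≡-Reasoning
    H H′ : Vec ℕ (suc n) → ℚ
    H z = G (x ∷ z)
    H′ z = if not (x ≤*ᵇ z) then H z else 0ℚ
    withMinAt-H′ : ∀ m j z → m ≤* z → withMinAt H′ m j z ≡ (if does (m <? x) then withMinAt H m j z else 0ℚ)
    withMinAt-H′ m j z m≤*z = begin
      (if aboveBefore j m z then (if not (x ≤*ᵇ insertAt z j m) then H (insertAt z j m) else 0ℚ) else 0ℚ)
        ≡⟨ cong (λ c → if aboveBefore j m z then (if c then H (insertAt z j m) else 0ℚ) else 0ℚ)
                (trans (cong not (≤*ᵇ-insertAt-min x z j m m≤*z)) (Bool.not-involutive _)) ⟩
      (if aboveBefore j m z then (if does (m <? x) then H (insertAt z j m) else 0ℚ) else 0ℚ)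
        ≡⟨ if-comm (aboveBefore j m z) (does (m <? x)) _ ⟩
      (if does (m <? x) then withMinAt H m j z else 0ℚ)
        ∎
    ∑-withMinAt-H′ : ∀ m j → ∑[ z ∈ words m n ] withMinAt H′ m j z ≡ (if does (m <? x) then ∑[ z ∈ words m n ] withMinAt H m j z else 0ℚ)
    ∑-withMinAt-H′ m j = trans (∑-cong-All (words m n) (words-≥ m n) (withMinAt-H′ m j)) (∑-if (words m n) (does (m <? x)) _)

  -- Every word of length n + 1 is uniquely z with its minimal letter m inserted at the first position j where m occurs.
  ∑-words-by-min : ∀ n → MinDecomposition n
  ∑-words-by-min zero    b G = trans (∑-words-suc b zero G) (∑-cong (letters b) (λ x → sym (ℚ.+-identityʳ _)))
  ∑-words-by-min (suc n) b G = begin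
    ∑ (words b (suc (suc n))) G
      ≡⟨ ∑-words-suc b (suc n) G ⟩
    ∑[ x ∈ letters b ] ∑[ z ∈ words b (suc n) ] G (x ∷ z)
      ≡⟨ ∑-cong-All (letters b) (letters-≥ b) (λ x b≤x → ∑-words-split-head (∑-words-by-min n) x b≤x G) ⟩
    ∑[ x ∈ letters b ] ((∑[ z ∈ words x (suc n) ] G (x ∷ z)) + (∑[ m ∈ letters b ] (if does (m <? x) then V x m else 0ℚ)))
      ≡⟨ ∑-+ (letters b) _ _ ⟩
    (∑[ x ∈ letters b ] ∑[ z ∈ words x (suc n) ] G (x ∷ z)) + (∑[ x ∈ letters b ] ∑[ m ∈ letters b ] (if does (m <? x) then V x m else 0ℚ))
      ≡⟨ cong (_+_ (∑[ x ∈ letters b ] ∑[ z ∈ words x (suc n) ] G (x ∷ z))) (∑-letters-< b V) ⟩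
    (∑[ m ∈ letters b ] ∑[ z ∈ words m (suc n) ] G (m ∷ z)) + (∑[ m ∈ letters b ] ∑[ x ∈ letters (suc m) ] V x m)
      ≡⟨ ∑-+ (letters b) _ _ ⟨
    ∑[ m ∈ letters b ] ((∑[ z ∈ words m (suc n) ] G (m ∷ z)) + (∑[ x ∈ letters (suc m) ] V x m))
      ≡⟨ ∑-cong (letters b) (λ m → cong (_+_ (∑[ z ∈ words m (suc n) ] G (m ∷ z))) (trans (∑-comm (letters (suc m)) (allFin (suc n)) _)
           (∑-cong (allFin (suc n)) λ j → sym (∑-withMinAt-suc m j G)))) ⟩
    ∑[ m ∈ letters b ] ((∑[ z ∈ words m (suc n) ] G (m ∷ z)) + (∑[ j ∈ allFin (suc n) ] ∑[ z ∈ words m (suc n) ] withMinAt G m (suc j) z))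
      ≡⟨ ∑-cong (letters b) (λ m → ∑-allFin-suc (λ j → ∑[ z ∈ words m (suc n) ] withMinAt G m j z)) ⟨
    ∑[ m ∈ letters b ] ∑[ j ∈ allFin (suc (suc n)) ] ∑[ z ∈ words m (suc n) ] withMinAt G m j z
      ∎
    where
    open ≡-Reasoning
    V : ℕ → ℕ → ℚ
    V x m = ∑[ j ∈ allFin (suc n) ] ∑[ z ∈ words m n ] withMinAt (G ∘ (x ∷_)) m j z

  ∑-letters-C : ∀ {e m} → e ≤ m → ∀ b → ∑[ x ∈ letters b ] fromℕ ((e ℕ.+ (a ∸ suc x)) C m) ≡ fromℕ ((e ℕ.+ (a ∸ b)) C suc m)
  ∑-letters-C {e} {m} e≤m b = go (a ∸ b) b refl
    where
    go : ∀ k b → a ∸ b ≡ k → ∑[ x ∈ letters b ] fromℕ ((e ℕ.+ (a ∸ suc x)) C m) ≡ fromℕ ((e ℕ.+ (a ∸ b)) C suc m)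
    go zero b a∸b≡0 rewrite a∸b≡0 =
      sym (cong fromℕ (trans (cong (_C suc m) (ℕ.+-identityʳ e)) (k>n⇒nCk≡0 (s≤s e≤m))))
    go (suc k) b a∸b≡1+k rewrite a∸b≡1+k = begin
      fromℕ ((e ℕ.+ (a ∸ suc b)) C m) + (∑[ x ∈ range (suc b) k ] fromℕ ((e ℕ.+ (a ∸ suc x)) C m))
        ≡⟨ cong₂ (λ c L → fromℕ ((e ℕ.+ c) C m) + (∑[ x ∈ L ] fromℕ ((e ℕ.+ (a ∸ suc x)) C m))) a∸1+b≡k (cong (range (suc b)) (sym a∸1+b≡k)) ⟩
      fromℕ ((e ℕ.+ k) C m) + (∑[ x ∈ letters (suc b) ] fromℕ ((e ℕ.+ (a ∸ suc x)) C m))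
        ≡⟨ cong (_+_ (fromℕ ((e ℕ.+ k) C m))) (trans (go k (suc b) a∸1+b≡k) (cong (λ c → fromℕ ((e ℕ.+ c) C suc m)) a∸1+b≡k)) ⟩
      fromℕ ((e ℕ.+ k) C m) + fromℕ ((e ℕ.+ k) C suc m)
        ≡⟨ fromℕ-+ ((e ℕ.+ k) C m) ((e ℕ.+ k) C suc m) ⟨
      fromℕ ((e ℕ.+ k) C m ℕ.+ (e ℕ.+ k) C suc m)
        ≡⟨ cong fromℕ (nCk+nC[k+1]≡[n+1]C[k+1] (e ℕ.+ k) m) ⟩
      fromℕ (suc (e ℕ.+ k) C suc m)
        ≡⟨ cong (λ c → fromℕ (c C suc m)) (ℕ.+-suc e k) ⟨
      fromℕ ((e ℕ.+ suc k) C suc m)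
        ∎
      where
      open ≡-Reasoning
      a∸1+b≡k : a ∸ suc b ≡ k
      a∸1+b≡k = trans (sym (ℕ.pred[m∸n]≡m∸[1+n] a b)) (cong ℕ.pred a∸b≡1+k)

  -- Counts the words z ≥ m that, with m inserted at position j as first minimum, standardize to insert₀ p j:
  -- if the smallest entry of p lies before position j then z must avoid m, otherwise it ranges over [m, a).
  minCount : ∀ {n} → ℕ → Fin (suc n) → Perm n → ℕ
  minCount m j p = if headBelow (inverse p) j then shuffleCount (a ∸ suc m) p else shuffleCount (a ∸ m) p

  minCount-≡ : ∀ {n} {p : Perm n} → IsPerm p → ∀ j {m} → m < a →
               minCount m j p ≡ ((n ∸ des (inverse (insert₀ p j))) ℕ.+ (a ∸ suc m)) C n
  minCount-≡ {n} {p} p-perm j {m} m<a with headBelow (inverse p) j in h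
  ... | true  = cong (_C n) (begin
    n ℕ.+ (a ∸ suc m) ∸ d ∸ 1       ≡⟨ ∸-∸-1 (n ℕ.+ (a ∸ suc m)) d ⟩
    n ℕ.+ (a ∸ suc m) ∸ suc d       ≡⟨ ℕ.+-∸-comm (a ∸ suc m) (subst (_≤ n) D≡ (des-≤ (inverse (insert₀ p j)))) ⟩
    (n ∸ suc d) ℕ.+ (a ∸ suc m)     ≡⟨ cong (λ e → (n ∸ e) ℕ.+ (a ∸ suc m)) D≡ ⟨
    (n ∸ D) ℕ.+ (a ∸ suc m)         ∎)
    where
    open ≡-Reasoning
    d D : ℕ
    d = des (inverse p)
    D = des (inverse (insert₀ p j))
    D≡ : D ≡ suc d
    D≡ = trans (des-inverse-insert₀ p-perm j) (cong (λ b → iverson b ℕ.+ d) h)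
  ... | false = cong (_C n) (begin
    n ℕ.+ (a ∸ m) ∸ d ∸ 1           ≡⟨ cong (λ e → n ℕ.+ e ∸ d ∸ 1) (ℕ.+-∸-assoc 1 m<a) ⟩
    n ℕ.+ suc (a ∸ suc m) ∸ d ∸ 1   ≡⟨ ∸-∸-1 (n ℕ.+ suc (a ∸ suc m)) d ⟩
    n ℕ.+ suc (a ∸ suc m) ∸ suc d   ≡⟨ cong (_∸ suc d) (ℕ.+-suc n (a ∸ suc m)) ⟩
    n ℕ.+ (a ∸ suc m) ∸ d           ≡⟨ ℕ.+-∸-comm (a ∸ suc m) (subst (_≤ n) D≡ (des-≤ (inverse (insert₀ p j)))) ⟩
    (n ∸ d) ℕ.+ (a ∸ suc m)         ≡⟨ cong (λ e → (n ∸ e) ℕ.+ (a ∸ suc m)) D≡ ⟨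
    (n ∸ D) ℕ.+ (a ∸ suc m)         ∎)
    where
    open ≡-Reasoning
    d D : ℕ
    d = des (inverse p)
    D = des (inverse (insert₀ p j))
    D≡ : D ≡ d
    D≡ = trans (des-inverse-insert₀ p-perm j) (cong (λ b → iverson b ℕ.+ d) h)

  ∑-letters-minCount : ∀ {n} {p : Perm n} → IsPerm p → ∀ j b →
                       ∑[ m ∈ letters b ] fromℕ (minCount m j p) ≡ fromℕ (shuffleCount (a ∸ b) (insert₀ p j))
  ∑-letters-minCount {n} {p} p-perm j b = begin
    ∑[ m ∈ letters b ] fromℕ (minCount m j p)                 ≡⟨ ∑-cong-All (letters b) (letters-< b) (λ m m<a → cong fromℕ (minCount-≡ p-perm j m<a)) ⟩
    ∑[ m ∈ letters b ] fromℕ (((n ∸ D) ℕ.+ (a ∸ suc m)) C n)  ≡⟨ ∑-letters-C (ℕ.m∸n≤m n D) b ⟩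
    fromℕ (((n ∸ D) ℕ.+ (a ∸ b)) C suc n)                     ≡⟨ cong fromℕ (shuffleCount-insert₀ (a ∸ b) p j) ⟨
    fromℕ (shuffleCount (a ∸ b) (insert₀ p j))                ∎
    where
    open ≡-Reasoning
    D : ℕ
    D = des (inverse (insert₀ p j))

  StandardizationCount : ℕ → Set
  StandardizationCount n = ∀ b (F : Perm n → ℚ) →
    ∑[ z ∈ words b n ] F (standardize z) ≡ ∑[ p ∈ perms n ] fromℕ (shuffleCount (a ∸ b) p) * F p

  fromℕ-if-* : ∀ h (X Y : ℕ) (f : ℚ) → (fromℕ X * f + fromℕ Y * (if not h then f else 0ℚ)) - fromℕ X * (if not h then f else 0ℚ) ≡ fromℕ (if h then X else Y) * f
  fromℕ-if-* true  X Y f = solve 3 (λ x y f → (x :* f :+ y :* con 0ℚ) :- x :* con 0ℚ := x :* f) refl (fromℕ X) (fromℕ Y) f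
    where open +-*-Solver
  fromℕ-if-* false X Y f = solve 3 (λ x y f → (x :* f :+ y :* f) :- x :* f := y :* f) refl (fromℕ X) (fromℕ Y) f
    where open +-*-Solver

  ∑-withMinAt-standardize : ∀ {n} → StandardizationCount n → ∀ m j (F : Perm (suc n) → ℚ) →
    ∑[ z ∈ words m n ] withMinAt (F ∘ standardize) m j z ≡ ∑[ p ∈ perms n ] fromℕ (minCount m j p) * F (insert₀ p j)
  ∑-withMinAt-standardize {n} count m j F = begin
    ∑[ z ∈ words m n ] withMinAt (F ∘ standardize) m j z
      ≡⟨ ∑-cong-All (words m n) (words-≥ m n) guarded ⟩
    ∑[ z ∈ words m n ] (if (suc m ≤*ᵇ z) ∨ zeroFrom (standardize z) then Φ z else 0ℚ)
      ≡⟨ ∑-cong (words m n) (λ z → if-∨ (suc m ≤*ᵇ z) (zeroFrom (standardize z)) (Φ z)) ⟩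
    ∑[ z ∈ words m n ] (((if suc m ≤*ᵇ z then Φ z else 0ℚ) + Ψ z) - (if suc m ≤*ᵇ z then Ψ z else 0ℚ))
      ≡⟨ trans (∑-minus (words m n) _ _) (cong (_- ∑ (words m n) (λ z → if suc m ≤*ᵇ z then Ψ z else 0ℚ)) (∑-+ (words m n) _ Ψ)) ⟩
    ((∑[ z ∈ words m n ] (if suc m ≤*ᵇ z then Φ z else 0ℚ)) + (∑[ z ∈ words m n ] Ψ z)) - (∑[ z ∈ words m n ] (if suc m ≤*ᵇ z then Ψ z else 0ℚ))
      ≡⟨ cong₂ (λ s t → (s + ∑ (words m n) Ψ) - t) (∑-words-≤*ᵇ (ℕ.n≤1+n m) n Φ) (∑-words-≤*ᵇ (ℕ.n≤1+n m) n Ψ) ⟩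
    ((∑[ z ∈ words (suc m) n ] Φ z) + (∑[ z ∈ words m n ] Ψ z)) - (∑[ z ∈ words (suc m) n ] Ψ z)
      ≡⟨ cong₂ _-_ (cong₂ _+_ (count (suc m) F′) (count m F″)) (count (suc m) F″) ⟩
    ((∑[ p ∈ perms n ] x p * F′ p) + (∑[ p ∈ perms n ] y p * F″ p)) - (∑[ p ∈ perms n ] x p * F″ p)
      ≡⟨ trans (∑-minus (perms n) _ _) (cong (_- ∑ (perms n) (λ p → x p * F″ p)) (∑-+ (perms n) _ _)) ⟨
    ∑[ p ∈ perms n ] ((x p * F′ p + y p * F″ p) - x p * F″ p)
      ≡⟨ ∑-cong (perms n) (λ p → fromℕ-if-* (headBelow (inverse p) j) _ _ (F′ p)) ⟩
    ∑[ p ∈ perms n ] fromℕ (minCount m j p) * F (insert₀ p j)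
      ∎
    where
    open ≡-Reasoning
    zeroFrom : Perm n → Bool
    zeroFrom p = not (headBelow (inverse p) j)
    F′ F″ : Perm n → ℚ
    F′ p = F (insert₀ p j)
    F″ p = if zeroFrom p then F′ p else 0ℚ
    Φ Ψ : Vec ℕ n → ℚ
    Φ = F′ ∘ standardize
    Ψ = F″ ∘ standardize
    x y : Perm n → ℚ
    x p = fromℕ (shuffleCount (a ∸ suc m) p)
    y p = fromℕ (shuffleCount (a ∸ m) p)
    guarded : ∀ z → m ≤* z → withMinAt (F ∘ standardize) m j z ≡ (if (suc m ≤*ᵇ z) ∨ zeroFrom (standardize z) then Φ z else 0ℚ)
    guarded z m≤*z = trans (if-congᵗ (aboveBefore j m z) (cong F ∘ standardize-insertAt z j m m≤*z))
                           (cong (λ c → if c then Φ z else 0ℚ) (aboveBefore-≡ z j m m≤*z))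

  standardizationCount : ∀ n → StandardizationCount n
  standardizationCount zero    b F = sym (trans (ℚ.+-identityʳ _) (trans (ℚ.*-identityˡ (F [])) (sym (ℚ.+-identityʳ _))))
  standardizationCount (suc n) b F = begin
    ∑[ z ∈ words b (suc n) ] F (standardize z)
      ≡⟨ ∑-words-by-min n b (F ∘ standardize) ⟩
    ∑[ m ∈ letters b ] ∑[ j ∈ allFin (suc n) ] ∑[ z ∈ words m n ] withMinAt (F ∘ standardize) m j z
      ≡⟨ ∑-cong (letters b) (λ m → ∑-cong (allFin (suc n)) λ j → ∑-withMinAt-standardize (standardizationCount n) m j F) ⟩
    ∑[ m ∈ letters b ] ∑[ j ∈ allFin (suc n) ] ∑[ p ∈ perms n ] fromℕ (minCount m j p) * F (insert₀ p j)
      ≡⟨ ∑-cong (letters b) (λ m → ∑-comm (allFin (suc n)) (perms n) _) ⟩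
    ∑[ m ∈ letters b ] ∑[ p ∈ perms n ] ∑[ j ∈ allFin (suc n) ] fromℕ (minCount m j p) * F (insert₀ p j)
      ≡⟨ ∑-comm (letters b) (perms n) _ ⟩
    ∑[ p ∈ perms n ] ∑[ m ∈ letters b ] ∑[ j ∈ allFin (suc n) ] fromℕ (minCount m j p) * F (insert₀ p j)
      ≡⟨ ∑-cong (perms n) (λ p → ∑-comm (letters b) (allFin (suc n)) _) ⟩
    ∑[ p ∈ perms n ] ∑[ j ∈ allFin (suc n) ] ∑[ m ∈ letters b ] fromℕ (minCount m j p) * F (insert₀ p j)
      ≡⟨ ∑-cong-All (perms n) (perms-isPerm n) (λ p p-perm → ∑-cong (allFin (suc n)) λ j →
           trans (∑-*ʳ (letters b) _ (F (insert₀ p j))) (cong (_* F (insert₀ p j)) (∑-letters-minCount p-perm j b))) ⟩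
    ∑[ p ∈ perms n ] ∑[ j ∈ allFin (suc n) ] fromℕ (shuffleCount (a ∸ b) (insert₀ p j)) * F (insert₀ p j)
      ≡⟨ ∑-perms-suc (λ w → fromℕ (shuffleCount (a ∸ b) w) * F w) ⟨
    ∑[ w ∈ perms (suc n) ] fromℕ (shuffleCount (a ∸ b) w) * F w
      ∎
    where open ≡-Reasoning

  ∑-words-one : ∀ b n → ∑[ z ∈ words b n ] 1ℚ ≡ fromℕ ((a ∸ b) ^ n)
  ∑-words-one b zero    = refl
  ∑-words-one b (suc n) = begin
    ∑[ z ∈ words b (suc n) ] 1ℚ                          ≡⟨ ∑-words-suc b n (λ _ → 1ℚ) ⟩
    ∑[ x ∈ letters b ] ∑[ z ∈ words b n ] 1ℚ             ≡⟨ ∑-cong (letters b) (λ _ → ∑-words-one b n) ⟩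
    ∑[ x ∈ letters b ] fromℕ ((a ∸ b) ^ n)               ≡⟨ ∑-const (letters b) _ ⟩
    fromℕ (List.length (letters b)) * fromℕ ((a ∸ b) ^ n) ≡⟨ cong (λ l → fromℕ l * fromℕ ((a ∸ b) ^ n)) (length-range (a ∸ b) b) ⟩
    fromℕ (a ∸ b) * fromℕ ((a ∸ b) ^ n)                  ≡⟨ fromℕ-* (a ∸ b) ((a ∸ b) ^ n) ⟨
    fromℕ ((a ∸ b) ^ suc n)                              ∎
    where open ≡-Reasoning

  ∑-words-sign-suc-suc : ∀ n b → ∑[ z ∈ words b (suc (suc n)) ] [-1]^ invᵥ z ≡ fromℕ (a ∸ b) * (∑[ z ∈ words b n ] [-1]^ invᵥ z)
  ∑-words-sign-suc-suc n b = begin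
    ∑[ z ∈ words b (suc (suc n)) ] [-1]^ invᵥ z
      ≡⟨ trans (∑-words-suc b (suc n) _) (∑-cong (letters b) (λ x → ∑-words-suc b n _)) ⟩
    ∑[ x ∈ letters b ] ∑[ y ∈ letters b ] ∑[ z ∈ words b n ] [-1]^ invᵥ (x ∷ y ∷ z)
      ≡⟨ ∑-cong (letters b) (λ x → ∑-cong (letters b) λ y → ∑-cong (words b n) (sign-∷-∷ x y)) ⟩
    ∑[ x ∈ letters b ] ∑[ y ∈ letters b ] ∑[ z ∈ words b n ] P x y z * [-1]^ invᵥ z
      ≡⟨ trans (∑-cong (letters b) (λ x → ∑-comm (letters b) (words b n) _)) (∑-comm (letters b) (words b n) _) ⟩
    ∑[ z ∈ words b n ] ∑[ x ∈ letters b ] ∑[ y ∈ letters b ] P x y z * [-1]^ invᵥ z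
      ≡⟨ ∑-cong (words b n) (λ z → trans (∑-cong (letters b) (λ x → ∑-*ʳ (letters b) _ _)) (∑-*ʳ (letters b) _ _)) ⟩
    ∑[ z ∈ words b n ] (∑[ x ∈ letters b ] ∑[ y ∈ letters b ] P x y z) * [-1]^ invᵥ z
      ≡⟨ ∑-cong (words b n) (λ z → cong (_* [-1]^ invᵥ z) (∑-range-pairs (a ∸ b) b (λ x → [-1]^ countBelow x (toList z)) (λ x → [-1]^-square (countBelow x (toList z))))) ⟩
    ∑[ z ∈ words b n ] fromℕ (a ∸ b) * [-1]^ invᵥ z
      ≡⟨ ∑-*ˡ (words b n) (fromℕ (a ∸ b)) _ ⟩
    fromℕ (a ∸ b) * (∑[ z ∈ words b n ] [-1]^ invᵥ z)
      ∎
    where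
    open ≡-Reasoning
    P : ℕ → ℕ → Vec ℕ n → ℚ
    P x y z = [-1]^ iverson (does (y <? x)) * ([-1]^ countBelow x (toList z) * [-1]^ countBelow y (toList z))
    sign-∷-∷ : ∀ x y z → [-1]^ invᵥ (x ∷ y ∷ z) ≡ P x y z * [-1]^ invᵥ z
    sign-∷-∷ x y z = begin
      [-1]^ invᵥ (x ∷ y ∷ z)
        ≡⟨ [-1]^-invᵥ-∷ x (y ∷ z) ⟩
      [-1]^ countBelow x (y ∷ toList z) * [-1]^ invᵥ (y ∷ z)
        ≡⟨ cong₂ _*_ ([-1]^-countBelow-∷ x y (toList z)) ([-1]^-invᵥ-∷ y z) ⟩
      ([-1]^ iverson (does (y <? x)) * [-1]^ countBelow x (toList z)) * ([-1]^ countBelow y (toList z) * [-1]^ invᵥ z)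
        ≡⟨ solve 4 (λ s u v w → (s :* u) :* (v :* w) := (s :* (u :* v)) :* w) refl
             ([-1]^ iverson (does (y <? x))) ([-1]^ countBelow x (toList z)) ([-1]^ countBelow y (toList z)) ([-1]^ invᵥ z) ⟩
      P x y z * [-1]^ invᵥ z
        ∎
      where open +-*-Solver

  ∑-words-sign : ∀ n → ∑[ z ∈ words 0 n ] [-1]^ invᵥ z ≡ fromℕ (a ^ ⌈ n /2⌉)
  ∑-words-sign zero          = refl
  ∑-words-sign (suc zero)    = begin
    ∑[ z ∈ words 0 1 ] [-1]^ invᵥ z          ≡⟨ ∑-words-suc 0 0 _ ⟩
    ∑[ x ∈ letters 0 ] (1ℚ + 0ℚ)             ≡⟨ ∑-const (letters 0) (1ℚ + 0ℚ) ⟩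
    fromℕ (List.length (letters 0)) * 1ℚ     ≡⟨ ℚ.*-identityʳ _ ⟩
    fromℕ (List.length (letters 0))          ≡⟨ cong fromℕ (trans (length-range a 0) (sym (ℕ.*-identityʳ a))) ⟩
    fromℕ (a ^ 1)                            ∎
    where open ≡-Reasoning
  ∑-words-sign (suc (suc n)) = begin
    ∑[ z ∈ words 0 (suc (suc n)) ] [-1]^ invᵥ z    ≡⟨ ∑-words-sign-suc-suc n 0 ⟩
    fromℕ a * (∑[ z ∈ words 0 n ] [-1]^ invᵥ z)    ≡⟨ cong (fromℕ a *_) (∑-words-sign n) ⟩
    fromℕ a * fromℕ (a ^ ⌈ n /2⌉)                 ≡⟨ fromℕ-* a (a ^ ⌈ n /2⌉) ⟨
    fromℕ (a ^ suc ⌈ n /2⌉)                        ∎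
    where open ≡-Reasoning

-- Iterated shuffles

1/ℕ-cong : ∀ {m n} .{{_ : NonZero m}} .{{_ : NonZero n}} → m ≡ n → 1/ℕ m ≡ 1/ℕ n
1/ℕ-cong refl = refl

infix 9 1/_^_

1/_^_ : (m e : ℕ) → .{{NonZero m}} → ℚ
1/ m ^ e = 1/ℕ (m ^ e) {{ℕ.m^n≢0 m e}}

1/^-+ : ∀ m e f .{{_ : NonZero m}} → 1/ m ^ (e ℕ.+ f) ≡ 1/ m ^ e * 1/ m ^ f
1/^-+ m e f = trans (1/ℕ-cong {{ℕ.m^n≢0 m (e ℕ.+ f)}} {{ℕ.m*n≢0 (m ^ e) (m ^ f) {{ℕ.m^n≢0 m e}} {{ℕ.m^n≢0 m f}}}} (ℕ.^-distribˡ-+-* m e f))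
                    (1/ℕ-* (m ^ e) (m ^ f) {{ℕ.m^n≢0 m e}} {{ℕ.m^n≢0 m f}})

1/^-^ℚ : ∀ m e k .{{_ : NonZero m}} → (1/ m ^ e) ^ℚ k ≡ 1/ m ^ (e ℕ.* k)
1/^-^ℚ m e zero    = cong (1/ m ^_) (sym (ℕ.*-zeroʳ e))
1/^-^ℚ m e (suc k) = begin
  1/ m ^ e * (1/ m ^ e) ^ℚ k     ≡⟨ cong (1/ m ^ e *_) (1/^-^ℚ m e k) ⟩
  1/ m ^ e * 1/ m ^ (e ℕ.* k)    ≡⟨ 1/^-+ m e (e ℕ.* k) ⟨
  1/ m ^ (e ℕ.+ e ℕ.* k)         ≡⟨ cong (1/ m ^_) (ℕ.*-suc e k) ⟨
  1/ m ^ (e ℕ.* suc k)           ∎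
  where open ≡-Reasoning

1ℚ^ : ∀ k → 1ℚ ^ℚ k ≡ 1ℚ
1ℚ^ zero    = refl
1ℚ^ (suc k) = trans (ℚ.*-identityˡ _) (1ℚ^ k)

½-+ : ∀ x → ½ * (x + x) ≡ x
½-+ x = begin
  ½ * (x + x)                  ≡⟨ cong (½ *_) (trans (cong₂ _+_ (sym (ℚ.*-identityˡ x)) (sym (ℚ.*-identityˡ x))) (sym (ℚ.*-distribʳ-+ x 1ℚ 1ℚ))) ⟩
  ½ * ((1ℚ + 1ℚ) * x)          ≡⟨ ℚ.*-assoc ½ (fromℕ 2) x ⟨
  (½ * fromℕ 2) * x            ≡⟨ cong (_* x) (trans (ℚ.*-comm ½ (fromℕ 2)) (fromℕ-*-1/ℕ 2)) ⟩
  1ℚ * x                       ≡⟨ ℚ.*-identityˡ x ⟩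
  x                            ∎
  where open ≡-Reasoning

even-indicator : ∀ m (x : ℚ) → (if does (m ℕ.% 2 ℕ.≟ 0) then x else 0ℚ) ≡ ½ * (x + [-1]^ m * x)
even-indicator zero          x = trans (sym (½-+ x)) (cong (λ y → ½ * (x + y)) (sym (ℚ.*-identityˡ x)))
even-indicator (suc zero)    x = sym (solve 2 (λ h x → h :* (x :+ (:- con 1ℚ) :* x) := con 0ℚ) refl ½ x)
  where open +-*-Solver
even-indicator (suc (suc m)) x = begin
  (if does (suc (suc m) ℕ.% 2 ℕ.≟ 0) then x else 0ℚ)   ≡⟨ cong (λ r → if does (r ℕ.≟ 0) then x else 0ℚ) (trans (cong (ℕ._% 2) (ℕ.+-comm 2 m)) (ℕ.[m+n]%n≡m%n m 2)) ⟩
  (if does (m ℕ.% 2 ℕ.≟ 0) then x else 0ℚ)             ≡⟨ even-indicator m x ⟩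
  ½ * (x + [-1]^ m * x)                                ≡⟨ cong (λ s → ½ * (x + s * x)) (neg-involutive ([-1]^ m)) ⟨
  ½ * (x + [-1]^ suc (suc m) * x)                      ∎
  where
  open ≡-Reasoning
  neg-involutive : ∀ s → - - s ≡ s
  neg-involutive = solve 1 (λ s → :- :- s := s) refl
    where open +-*-Solver

record IsCharacter {n} (χ : Perm n → ℚ) : Set where
  field
    χ-identity : χ (identity n) ≡ 1ℚ
    χ-∘ₚ       : ∀ {v u} → IsPerm v → IsPerm u → χ (v ∘ₚ u) ≡ χ v * χ u

open IsCharacter

trivial-isCharacter : ∀ {n} → IsCharacter {n} (λ _ → 1ℚ)
trivial-isCharacter = record { χ-identity = refl ; χ-∘ₚ = λ _ _ → refl }

sgn-isCharacter : ∀ {n} → IsCharacter {n} sgn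
sgn-isCharacter {n} = record { χ-identity = sgn-identity n ; χ-∘ₚ = sgn-∘ₚ }

≟ₚ-sym : ∀ {n} (v w : Perm n) → does (v ≟ₚ w) ≡ does (w ≟ₚ v)
≟ₚ-sym v w = does-⇔ sym sym (v ≟ₚ w) (w ≟ₚ v)

module _ (a : ℕ) .{{_ : NonZero a}} where

  ∑-iterProb-zero : ∀ {n} (χ : Perm n → ℚ) → ∑[ w ∈ perms n ] χ w * iterProb a 0 w ≡ χ (identity n)
  ∑-iterProb-zero {n} χ = begin
    ∑[ w ∈ perms n ] χ w * iterProb a 0 w
      ≡⟨ ∑-cong (perms n) (λ w → trans (if-*ˡ (χ w) _ 1ℚ) (cong₂ (λ b y → if b then y else 0ℚ) (≟ₚ-sym w (identity n)) (ℚ.*-identityʳ (χ w)))) ⟩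
    ∑[ w ∈ perms n ] (if does (identity n ≟ₚ w) then χ w else 0ℚ)
      ≡⟨ ∑-perms-δ (identity-isPerm n) χ ⟩
    χ (identity n)
      ∎
    where open ≡-Reasoning

  ∑-iterProb-suc : ∀ {n} {χ : Perm n → ℚ} → IsCharacter χ → ∀ k →
    ∑[ w ∈ perms n ] χ w * iterProb a (suc k) w ≡ (∑[ u ∈ perms n ] χ u * iterProb a k u) * (∑[ v ∈ perms n ] χ v * shuffleProb a v)
  ∑-iterProb-suc {n} {χ} χ-char k = begin
    ∑[ w ∈ perms n ] χ w * (∑[ u ∈ perms n ] ∑[ v ∈ perms n ] δ w u v (I u * P v))
      ≡⟨ ∑-cong (perms n) (λ w → trans (sym (∑-*ˡ (perms n) (χ w) _)) (∑-cong (perms n) λ u →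
           trans (sym (∑-*ˡ (perms n) (χ w) _)) (∑-cong (perms n) λ v → if-*ˡ (χ w) _ _))) ⟩
    ∑[ w ∈ perms n ] ∑[ u ∈ perms n ] ∑[ v ∈ perms n ] δ w u v (χ w * (I u * P v))
      ≡⟨ trans (∑-comm (perms n) (perms n) _) (∑-cong (perms n) λ u → ∑-comm (perms n) (perms n) _) ⟩
    ∑[ u ∈ perms n ] ∑[ v ∈ perms n ] ∑[ w ∈ perms n ] δ w u v (χ w * (I u * P v))
      ≡⟨ ∑-cong-All (perms n) (perms-isPerm n) (λ u u-perm → ∑-cong-All (perms n) (perms-isPerm n) λ v v-perm →
           trans (∑-perms-δ (∘ₚ-isPerm v-perm u-perm) (λ w → χ w * (I u * P v)))
                 (trans (cong (_* (I u * P v)) (χ-∘ₚ χ-char v-perm u-perm)) (regroup (χ v) (χ u) (I u) (P v)))) ⟩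
    ∑[ u ∈ perms n ] ∑[ v ∈ perms n ] (χ u * I u) * (χ v * P v)
      ≡⟨ trans (∑-cong (perms n) λ u → ∑-*ˡ (perms n) (χ u * I u) _) (∑-*ʳ (perms n) _ _) ⟩
    (∑[ u ∈ perms n ] χ u * I u) * (∑[ v ∈ perms n ] χ v * P v)
      ∎
    where
    open ≡-Reasoning
    I P : Perm n → ℚ
    I = iterProb a k
    P = shuffleProb a
    δ : Perm n → Perm n → Perm n → ℚ → ℚ
    δ w u v q = if does (v ∘ₚ u ≟ₚ w) then q else 0ℚ
    regroup : ∀ s t i p → (s * t) * (i * p) ≡ (t * i) * (s * p)
    regroup = solve 4 (λ s t i p → (s :* t) :* (i :* p) := (t :* i) :* (s :* p)) refl
      where open +-*-Solver

  ∑-iterProb : ∀ {n} {χ : Perm n → ℚ} → IsCharacter χ → ∀ k →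
    ∑[ w ∈ perms n ] χ w * iterProb a k w ≡ (∑[ v ∈ perms n ] χ v * shuffleProb a v) ^ℚ k
  ∑-iterProb {χ = χ} χ-char zero    = trans (∑-iterProb-zero χ) (χ-identity χ-char)
  ∑-iterProb {n} {χ} χ-char (suc k) = trans (∑-iterProb-suc χ-char k) (trans (cong (_* ρ) (∑-iterProb χ-char k)) (ℚ.*-comm (ρ ^ℚ k) ρ))
    where
    ρ : ℚ
    ρ = ∑[ v ∈ perms n ] χ v * shuffleProb a v

  open Words a

  ∑-shuffleProb : ∀ {n} (χ : Perm n → ℚ) →
    ∑[ v ∈ perms n ] χ v * shuffleProb a v ≡ (∑[ z ∈ words 0 n ] χ (standardize z)) * 1/ a ^ n
  ∑-shuffleProb {n} χ = begin
    ∑[ v ∈ perms n ] χ v * shuffleProb a v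
      ≡⟨ ∑-cong (perms n) (λ v → trans (cong (χ v *_) (/-≡-fromℕ-*-1/ℕ (shuffleCount a v) (a ^ n) {{ℕ.m^n≢0 a n}}))
                                        (swap (χ v) (fromℕ (shuffleCount a v)) (1/ a ^ n))) ⟩
    ∑[ v ∈ perms n ] (fromℕ (shuffleCount a v) * χ v) * 1/ a ^ n
      ≡⟨ ∑-*ʳ (perms n) _ (1/ a ^ n) ⟩
    (∑[ v ∈ perms n ] fromℕ (shuffleCount a v) * χ v) * 1/ a ^ n
      ≡⟨ cong (_* 1/ a ^ n) (standardizationCount n 0 χ) ⟨
    (∑[ z ∈ words 0 n ] χ (standardize z)) * 1/ a ^ n
      ∎
    where
    open ≡-Reasoning
    swap : ∀ c k d → c * (k * d) ≡ (k * c) * d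
    swap = solve 3 (λ c k d → c :* (k :* d) := (k :* c) :* d) refl
      where open +-*-Solver

  ∑-shuffleProb-total : ∀ n → ∑[ v ∈ perms n ] 1ℚ * shuffleProb a v ≡ 1ℚ
  ∑-shuffleProb-total n = trans (∑-shuffleProb {n} (λ _ → 1ℚ)) (trans (cong (_* 1/ a ^ n) (∑-words-one 0 n)) (fromℕ-*-1/ℕ (a ^ n) {{ℕ.m^n≢0 a n}}))

  ∑-sgn-shuffleProb : ∀ n → ∑[ v ∈ perms n ] sgn v * shuffleProb a v ≡ 1/ a ^ ⌊ n /2⌋
  ∑-sgn-shuffleProb n = begin
    ∑[ v ∈ perms n ] sgn v * shuffleProb a v
      ≡⟨ ∑-shuffleProb {n} sgn ⟩
    (∑[ z ∈ words 0 n ] sgn (standardize z)) * 1/ a ^ n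
      ≡⟨ cong₂ _*_ (trans (∑-cong (words 0 n) (λ z → cong [-1]^_ (inversions-standardize z))) (∑-words-sign n))
                   (trans (cong (1/ a ^_) (sym (ℕ.⌊n/2⌋+⌈n/2⌉≡n n))) (1/^-+ a ⌊ n /2⌋ ⌈ n /2⌉)) ⟩
    fromℕ (a ^ ⌈ n /2⌉) * (1/ a ^ ⌊ n /2⌋ * 1/ a ^ ⌈ n /2⌉)
      ≡⟨ solve 3 (λ c f g → c :* (f :* g) := f :* (c :* g)) refl (fromℕ (a ^ ⌈ n /2⌉)) (1/ a ^ ⌊ n /2⌋) (1/ a ^ ⌈ n /2⌉) ⟩
    1/ a ^ ⌊ n /2⌋ * (fromℕ (a ^ ⌈ n /2⌉) * 1/ a ^ ⌈ n /2⌉)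
      ≡⟨ cong (1/ a ^ ⌊ n /2⌋ *_) (fromℕ-*-1/ℕ (a ^ ⌈ n /2⌉) {{ℕ.m^n≢0 a ⌈ n /2⌉}}) ⟩
    1/ a ^ ⌊ n /2⌋ * 1ℚ
      ≡⟨ ℚ.*-identityʳ _ ⟩
    1/ a ^ ⌊ n /2⌋
      ∎
    where
    open ≡-Reasoning
    open +-*-Solver

⌊n/2⌋≡n/2 : ∀ n → ⌊ n /2⌋ ≡ n ℕ./ 2
⌊n/2⌋≡n/2 zero          = refl
⌊n/2⌋≡n/2 (suc zero)    = refl
⌊n/2⌋≡n/2 (suc (suc n)) = trans (cong suc (⌊n/2⌋≡n/2 n)) (sym (ℕ.m/n≡1+[m∸n]/n {suc (suc n)} {2} (s≤s (s≤s z≤n))))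

-- Both sides equal 1 when n = 0.
theorem1p4 : (n a k : ℕ) → 1 ≤ n → .{{_ : NonZero a}} → probSignOne n a k ≡ rhs n a k
theorem1p4 n a k _ = begin
  probSignOne n a k
    ≡⟨ ∑-cong (perms n) (λ w → even-indicator (inversions w) (iterProb a k w)) ⟩
  ∑[ w ∈ perms n ] ½ * (iterProb a k w + sgn w * iterProb a k w)
    ≡⟨ trans (∑-*ˡ (perms n) ½ _) (cong (½ *_) (∑-+ (perms n) _ _)) ⟩
  ½ * ((∑[ w ∈ perms n ] iterProb a k w) + (∑[ w ∈ perms n ] sgn w * iterProb a k w))
    ≡⟨ cong₂ (λ t s → ½ * (t + s)) (trans (∑-cong (perms n) (λ w → sym (ℚ.*-identityˡ _))) (∑-iterProb a (trivial-isCharacter {n}) k))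
                                   (∑-iterProb a (sgn-isCharacter {n}) k) ⟩
  ½ * ((∑[ v ∈ perms n ] 1ℚ * shuffleProb a v) ^ℚ k + (∑[ v ∈ perms n ] sgn v * shuffleProb a v) ^ℚ k)
    ≡⟨ cong₂ (λ t s → ½ * (t ^ℚ k + s ^ℚ k)) (∑-shuffleProb-total a n) (∑-sgn-shuffleProb a n) ⟩
  ½ * (1ℚ ^ℚ k + (1/ a ^ ⌊ n /2⌋) ^ℚ k)
    ≡⟨ cong₂ (λ t s → ½ * (t + s)) (1ℚ^ k) (trans (1/^-^ℚ a ⌊ n /2⌋ k) (cong (1/ a ^_) exponent)) ⟩
  ½ * (1ℚ + 1/ a ^ (k ℕ.* (n ℕ./ 2)))
    ≡⟨ trans (ℚ.*-distribˡ-+ ½ 1ℚ (1/ a ^ E)) (cong₂ _+_ (ℚ.*-identityʳ ½) (sym (1/ℕ-* 2 (a ^ E) {{_}} {{ℕ.m^n≢0 a E}}))) ⟩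
  rhs n a k
    ∎
  where
  open ≡-Reasoning
  E : ℕ
  E = k ℕ.* (n ℕ./ 2)
  exponent : ⌊ n /2⌋ ℕ.* k ≡ E
  exponent = trans (ℕ.*-comm ⌊ n /2⌋ k) (cong (k ℕ.*_) (⌊n/2⌋≡n/2 n))
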